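{- Let $q$ be a prime power and let $\mathcal W(5,q)$ be the symplectic polar space of ${\rm PG}(5,q)$ defined by the alternating form with Gram matrix $\begin{pmatrix}0_3 & I_3\\ -I_3 & 0_3\end{pmatrix}$, with polarity $\perp$. Let $\Pi_1=\langle U_4,U_5,U_6\rangle$, $\Pi_2=\langle U_1,U_2,U_3\rangle$. For each point $P\in\Pi_2$ choose a $3$-space $\Sigma_P\subseteq P^\perp$ with $P\notin \Sigma_P$, let $\mathcal W_P$ be the induced non-degenerate symplectic polar space on $\Sigma_P$, $r_P=\Sigma_P\cap\Pi_1$, $t_P=\Sigma_P\cap\Pi_2$, choose a line-spread $\mathcal F_P$ of $\mathcal W_P$ containing $r_P,t_P$, and let $\mathcal X_P=\{\langle P,\ell\rangle:\ell\in\mathcal F_P\setminus\{r_P,t_P\}\}$; put $\mathcal X=\bigcup_{P\in\Pi_2}\mathcal X_P\cup\{\Pi_2\}$. Let $R$ be a point of ${\rm PG}(5,q)\setminus(\Pi_1\cup\Pi_2)$ and let $\ell_R$ be the unique line through $R$ meeting both $\Pi_1$ and $\Pi_2$. Then the number of planes of $\mathcal X$ through $R$ is $q$ if $\ell_R$ is a line of $\mathcal W(5,q)$ (totally isotropic), and $q+1$ otherwise.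
   Context: $U_i$ is the point with $1$ in position $i$ and $0$ elsewhere. A line-spread of $\mathcal W_P$ is a set of pairwise disjoint totally isotropic lines of $\mathcal W_P$ partitioning the points of $\Sigma_P$. -}

module Defs where

open import Data.Nat using (ℕ; zero; suc)
open import Data.Fin using (Fin; zero; suc)
open import Data.Product using (Σ; ∃; _×_; _,_)
open import Data.Sum using (_⊎_)
open import Data.List using (List; length)
open import Data.List.Membership.Propositional using (_∈_)
open import Data.List.Relation.Unary.Any using (Any)
open import Data.List.Relation.Unary.All using (All)
open import Data.List.Relation.Unary.AllPairs using (AllPairs)
open import Data.List.Relation.Unary.Unique.Propositional using (Unique)
open import Relation.Nullary using (¬_)
open import Relation.Binary.PropositionalEquality using (_≡_; _≢_)
open import Relation.Binary.Definitions using (DecidableEquality)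
open import Algebra.Structures using (IsCommutativeRing)

-- A finite field (propositional equality), with an explicit enumeration
-- of its elements.  Its order  q = length elements  is then a prime power.

record FiniteField : Set₁ where
  field
    Carrier : Set
    _+_ _*_ : Carrier → Carrier → Carrier
    -_      : Carrier → Carrier
    0# 1#   : Carrier
    isCommutativeRing : IsCommutativeRing _≡_ _+_ _*_ -_ 0# 1#
    0≢1     : 0# ≢ 1#
    inverse : ∀ x → x ≢ 0# → Σ Carrier (λ y → x * y ≡ 1#)
    _≟_     : DecidableEquality Carrier
    elements : List Carrier
    elements-unique   : Unique elements
    elements-complete : ∀ x → x ∈ elements

  order : ℕ
  order = length elements

module Geometry (F : FiniteField) where
  open FiniteField F

  -- vectors of V(6,q); points of PG(5,q) are represented by nonzero vectors
  V : Set
  V = Fin 6 → Carrier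

  IsZero : V → Set
  IsZero v = ∀ j → v j ≡ 0#

  NonZero : V → Set
  NonZero v = ¬ IsZero v

  -- U_i : 1 in position i, 0 elsewhere (positions 0..5 here = 1..6 in paper)
  U : Fin 6 → V
  U i j with i Data.Fin.≟ j
  ... | Relation.Nullary.yes _ = 1#
  ... | Relation.Nullary.no  _ = 0#

  -- the alternating form with Gram matrix ((0, I3), (-I3, 0))
  B : V → V → Carrier
  B x y =
      ((x (# 0) * y (# 3)) + (- (x (# 3) * y (# 0))))
    + (((x (# 1) * y (# 4)) + (- (x (# 4) * y (# 1))))
    + ((x (# 2) * y (# 5)) + (- (x (# 5) * y (# 2)))))
    where open import Data.Fin using (#_)

  sumFin : ∀ {k} → (Fin k → Carrier) → Carrier
  sumFin {zero}  f = 0#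
  sumFin {suc k} f = f zero + sumFin (λ i → f (suc i))

  lincomb : ∀ {k} → (Fin k → Carrier) → (Fin k → V) → V
  lincomb c g j = sumFin (λ i → c i * g i j)

  _∈⟨_⟩ : ∀ {k} → V → (Fin k → V) → Set
  v ∈⟨ g ⟩ = ∃ λ c → ∀ j → v j ≡ lincomb c g j

  LinIndep : ∀ {k} → (Fin k → V) → Set
  LinIndep g = ∀ c → IsZero (lincomb c g) → ∀ i → c i ≡ 0#

  _≐_ : ∀ {k m} → (Fin k → V) → (Fin m → V) → Set
  g ≐ h = ∀ v → (v ∈⟨ g ⟩ → v ∈⟨ h ⟩) × (v ∈⟨ h ⟩ → v ∈⟨ g ⟩)

  TotallyIsotropic : ∀ {k} → (Fin k → V) → Set
  TotallyIsotropic g = ∀ u v → u ∈⟨ g ⟩ → v ∈⟨ g ⟩ → B u v ≡ 0#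

  -- a line / plane / solid of PG(5,q): vector subspaces of dim 2 / 3 / 4,
  -- given by linearly independent generators
  Line Plane Solid : Set
  Line  = Fin 2 → V
  Plane = Fin 3 → V
  Solid = Fin 4 → V

  Π₁ Π₂ : Plane
  Π₁ i = U (3 Data.Fin.↑ʳ i)
  Π₂ i = U (i Data.Fin.↑ˡ 3)

  -- Points of Π₂, each given by its normalised representative
  data Pt₂ : Set where
    pA : Carrier → Carrier → Pt₂   -- (1,a,b,0,0,0)
    pB : Carrier → Pt₂             -- (0,1,b,0,0,0)
    pC : Pt₂                       -- (0,0,1,0,0,0)

  vec : Pt₂ → V
  vec (pA a b) = lincomb (λ { zero → 1# ; (suc zero) → a ; (suc (suc zero)) → b }) Π₂
  vec (pB b)   = lincomb (λ { zero → 0# ; (suc zero) → 1# ; (suc (suc zero)) → b }) Π₂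
  vec pC       = lincomb (λ { zero → 0# ; (suc zero) → 0# ; (suc (suc zero)) → 1# }) Π₂

  join : V → Line → Plane
  join p ℓ zero = p
  join p ℓ (suc i) = ℓ i

  IsMeet : ∀ {k m} → Line → (Fin k → V) → (Fin m → V) → Set
  IsMeet ℓ g h = ∀ v → (v ∈⟨ ℓ ⟩ → (v ∈⟨ g ⟩ × v ∈⟨ h ⟩))
                     × ((v ∈⟨ g ⟩ × v ∈⟨ h ⟩) → v ∈⟨ ℓ ⟩)

  Disjoint : Line → Line → Set
  Disjoint ℓ m = ∀ v → v ∈⟨ ℓ ⟩ → v ∈⟨ m ⟩ → IsZero v

  record Choice (P : Pt₂) : Set where
    field
      Σ-P        : Solid
      Σ-indep    : LinIndep Σ-P
      Σ-in-P⊥    : ∀ i → B (vec P) (Σ-P i) ≡ 0#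
      P∉Σ        : ¬ (vec P ∈⟨ Σ-P ⟩)
      spread     : List Line
      spread-lines : All (λ ℓ → LinIndep ℓ × TotallyIsotropic ℓ
                                × (∀ i → ℓ i ∈⟨ Σ-P ⟩)) spread
      spread-disj  : AllPairs Disjoint spread
      spread-cover : ∀ v → NonZero v → v ∈⟨ Σ-P ⟩ → Any (λ ℓ → v ∈⟨ ℓ ⟩) spread
      r∈spread   : Any (λ ℓ → IsMeet ℓ Σ-P Π₁) spread
      t∈spread   : Any (λ ℓ → IsMeet ℓ Σ-P Π₂) spread

  module _ (C : (P : Pt₂) → Choice P) where
    open Choice

    InX : Plane → Set
    InX π = (π ≐ Π₂)
          ⊎ Σ Pt₂ (λ P → Any (λ ℓ → ¬ IsMeet ℓ (Σ-P (C P)) Π₁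
                                  × ¬ IsMeet ℓ (Σ-P (C P)) Π₂
                                  × (π ≐ join (vec P) ℓ)) (spread (C P)))

    -- the set of planes of 𝒳 through R has exactly n elements
    -- (planes counted as subspaces, i.e. up to ≐)
    PlanesThroughCount : V → ℕ → Set
    PlanesThroughCount R n =
      Σ (List Plane) λ Ls →
          length Ls ≡ n
        × All (λ π → LinIndep π × InX π × R ∈⟨ π ⟩) Ls
        × AllPairs (λ π π′ → ¬ (π ≐ π′)) Ls
        × (∀ π → LinIndep π → InX π → R ∈⟨ π ⟩ → Any (λ π′ → π ≐ π′) Ls)

-- Write R = α u + β w with u ∈ Π₁ and w ∈ Π₂ on ℓR, and let P_R be the point of Π₂ on ℓR.
-- A plane ⟨P, ℓ⟩ of 𝒳 lies in P^⊥, so if it contains R then R ∈ P^⊥. Conversely, for a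
-- point P of Π₂ ∩ R^⊥ we have P^⊥ = ⟨P⟩ ⊕ Σ_P, so R = λ P + σ with 0 ≠ σ ∈ Σ_P, and σ lies
-- on exactly one line ℓ of the spread F_P; then ⟨P, ℓ⟩ contains R. This ℓ is never t_P
-- (σ ∉ Π₂), and it is r_P exactly when σ ∈ Π₁, that is, when P = P_R. Distinct points give
-- distinct planes, and Π₂ misses R. So the planes of 𝒳 through R correspond to the points
-- other than P_R of the line R^⊥ ∩ Π₂ of PG(2, q), which has q + 1 points; and P_R is on it
-- iff B(P_R, R) = 0, a nonzero multiple of B(u, w), iff ℓR is totally isotropic.

module Submission where

open import Defs
open import Algebra.Bundles using (CommutativeRing; RawRing)
open import Algebra.Structures using (IsCommutativeRing)
import Algebra.Solver.Ring
import Algebra.Solver.Ring.AlmostCommutativeRing as ACR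
open import Data.Empty using (⊥-elim)
open import Data.Fin as Fin using (Fin; zero; suc; punchIn; punchOut; #_)
import Data.Fin.Properties as Fin
open import Data.Integer as ℤ using (ℤ; -[1+_]; sign; ∣_∣; _◃_; _⊖_)
import Data.Integer.Properties as ℤ
open import Data.List using (List; []; _∷_; length; map; filter)
open import Data.List.Membership.Propositional using (_∈_; _∉_; find; lose; mapWith∈)
open import Data.List.Membership.Propositional.Properties using (∈-map⁺; ∈-filter⁺; ∈-filter⁻)
open import Data.List.Membership.Setoid.Properties using (length-mapWith∈)
open import Data.List.Properties using (length-map; filter-accept; filter-reject; filter-all)
open import Data.List.Relation.Unary.All as All using (All; []; _∷_)
import Data.List.Relation.Unary.All.Properties as All
open import Data.List.Relation.Unary.AllPairs using (AllPairs; []; _∷_)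
open import Data.List.Relation.Unary.Any using (here; there)
open import Data.List.Relation.Unary.Any.Properties using (mapWith∈⁺; mapWith∈⁻)
open import Data.List.Relation.Unary.Unique.Propositional using (Unique)
import Data.List.Relation.Unary.Unique.Propositional.Properties as Unique
open import Data.Maybe using (Maybe; just; nothing)
open import Data.Nat as ℕ using (ℕ; zero; suc; s≤s)
import Data.Nat.Properties as ℕ
open import Data.Product using (Σ; ∃; _×_; _,_; proj₁; proj₂)
open import Data.Sign as Sign using (Sign)
open import Data.Sum using (_⊎_; inj₁; inj₂)
open import Data.Vec.Functional using (insertAt) renaming ([] to []ᵥ; _∷_ to _∷ᵥ_)
open import Data.Vec.Functional.Properties using (insertAt-lookup; insertAt-punchIn)
open import Function using (_∘_; id)
open import Relation.Binary.Definitions using (DecidableEquality)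
open import Relation.Binary.PropositionalEquality
open import Relation.Nullary using (¬_; ¬?; Dec; yes; no)

-- Coefficients are taken in ℤ, mapped canonically into the ring, so that the solver
-- compares normal forms by computation.
module IntegerCoefficientSolver
  {A : Set} {add mul : A → A → A} {neg : A → A} {zero′ one : A}
  (isCommutativeRing : IsCommutativeRing _≡_ add mul neg zero′ one) where

  ring : CommutativeRing _ _
  ring = record { isCommutativeRing = isCommutativeRing }

  open CommutativeRing ring using (_+_; _*_; -_; 0#; 1#; semiring; +-commutativeSemigroup; *-commutativeSemigroup; +-comm;
    +-identityˡ; +-identityʳ; *-identityˡ; *-identityʳ; -‿inverseʳ; zeroʳ) renaming (ring to ring′)
  open import Algebra.Properties.Ring ring′ using (-‿involutive; -0#≈0#; -1*x≈-x; -‿distribʳ-*; -‿+-comm)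
  open import Algebra.Properties.Semiring.Mult.TCOptimised semiring using (×-homo-+; ×1-homo-*) renaming (_×_ to _·_)
  open import Algebra.Properties.CommutativeSemigroup +-commutativeSemigroup using (interchange)
  open import Algebra.Properties.CommutativeSemigroup *-commutativeSemigroup using () renaming (interchange to *-interchange)
  open ≡-Reasoning

  sign⟦_⟧ : Sign → A
  sign⟦ Sign.+ ⟧ = 1#
  sign⟦ Sign.- ⟧ = - 1#

  ⟦_⟧ : ℤ → A
  ⟦ ℤ.+ n ⟧ = n · 1#
  ⟦ -[1+ n ] ⟧ = - (suc n · 1#)

  ⟦◃⟧ : ∀ s n → ⟦ s ◃ n ⟧ ≡ sign⟦ s ⟧ * (n · 1#)
  ⟦◃⟧ s       zero    = sym (zeroʳ _)
  ⟦◃⟧ Sign.+ (suc n) = sym (*-identityˡ _)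
  ⟦◃⟧ Sign.- (suc n) = sym (-1*x≈-x _)

  ⟦⟧-sign-abs : ∀ i → ⟦ i ⟧ ≡ sign⟦ sign i ⟧ * (∣ i ∣ · 1#)
  ⟦⟧-sign-abs i = trans (cong ⟦_⟧ (sym (ℤ.◃-inverse i))) (⟦◃⟧ (sign i) ∣ i ∣)

  sign⟦*⟧ : ∀ s t → sign⟦ s Sign.* t ⟧ ≡ sign⟦ s ⟧ * sign⟦ t ⟧
  sign⟦*⟧ Sign.+ t      = sym (*-identityˡ _)
  sign⟦*⟧ Sign.- Sign.+ = sym (*-identityʳ _)
  sign⟦*⟧ Sign.- Sign.- = begin
    1#                ≡⟨ sym (-‿involutive _) ⟩
    - (- 1#)          ≡⟨ cong -_ (sym (-1*x≈-x _)) ⟩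
    - ((- 1#) * 1#)   ≡⟨ -‿distribʳ-* _ _ ⟩
    (- 1#) * (- 1#)   ∎

  ⟦*⟧ : ∀ i j → ⟦ i ℤ.* j ⟧ ≡ ⟦ i ⟧ * ⟦ j ⟧
  ⟦*⟧ i j = begin
    ⟦ sign i Sign.* sign j ◃ ∣ i ∣ ℕ.* ∣ j ∣ ⟧
      ≡⟨ ⟦◃⟧ (sign i Sign.* sign j) (∣ i ∣ ℕ.* ∣ j ∣) ⟩
    sign⟦ sign i Sign.* sign j ⟧ * ((∣ i ∣ ℕ.* ∣ j ∣) · 1#)
      ≡⟨ cong₂ _*_ (sign⟦*⟧ (sign i) (sign j)) (×1-homo-* ∣ i ∣ ∣ j ∣) ⟩
    (sign⟦ sign i ⟧ * sign⟦ sign j ⟧) * ((∣ i ∣ · 1#) * (∣ j ∣ · 1#))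
      ≡⟨ *-interchange _ _ _ _ ⟩
    (sign⟦ sign i ⟧ * (∣ i ∣ · 1#)) * (sign⟦ sign j ⟧ * (∣ j ∣ · 1#))
      ≡⟨ sym (cong₂ _*_ (⟦⟧-sign-abs i) (⟦⟧-sign-abs j)) ⟩
    ⟦ i ⟧ * ⟦ j ⟧ ∎

  ⟦-⟧ : ∀ i → ⟦ ℤ.- i ⟧ ≡ - ⟦ i ⟧
  ⟦-⟧ (ℤ.+ zero)  = sym -0#≈0#
  ⟦-⟧ (ℤ.+ suc n) = refl
  ⟦-⟧ -[1+ n ]    = sym (-‿involutive _)

  ⟦⊖⟧ : ∀ m n → ⟦ m ⊖ n ⟧ ≡ m · 1# + - (n · 1#)
  ⟦⊖⟧ m zero = begin
    m · 1#              ≡⟨ sym (+-identityʳ _) ⟩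
    m · 1# + 0#         ≡⟨ cong ((m · 1#) +_) (sym -0#≈0#) ⟩
    m · 1# + - 0#       ∎
  ⟦⊖⟧ zero (suc n) = sym (+-identityˡ _)
  ⟦⊖⟧ (suc m) (suc n) = begin
    ⟦ suc m ⊖ suc n ⟧                               ≡⟨ cong ⟦_⟧ (ℤ.[1+m]⊖[1+n]≡m⊖n m n) ⟩
    ⟦ m ⊖ n ⟧                                       ≡⟨ ⟦⊖⟧ m n ⟩
    m · 1# + - (n · 1#)                             ≡⟨ sym (trans (cong (_+ (m · 1# + - (n · 1#))) (-‿inverseʳ 1#)) (+-identityˡ _)) ⟩
    (1# + - 1#) + (m · 1# + - (n · 1#))              ≡⟨ interchange _ _ _ _ ⟩
    (1# + m · 1#) + (- 1# + - (n · 1#))              ≡⟨ cong₂ _+_ (sym (×-homo-+ 1# 1 m)) (-‿+-comm _ _) ⟩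
    suc m · 1# + - (1# + n · 1#)                      ≡⟨ cong (λ a → suc m · 1# + - a) (sym (×-homo-+ 1# 1 n)) ⟩
    suc m · 1# + - (suc n · 1#)                       ∎

  ⟦+⟧ : ∀ i j → ⟦ i ℤ.+ j ⟧ ≡ ⟦ i ⟧ + ⟦ j ⟧
  ⟦+⟧ -[1+ m ] -[1+ n ] = begin
    - (suc (suc (m ℕ.+ n)) · 1#)        ≡⟨ cong (λ k → - (suc k · 1#)) (sym (ℕ.+-suc m n)) ⟩
    - ((suc m ℕ.+ suc n) · 1#)          ≡⟨ cong -_ (×-homo-+ 1# (suc m) (suc n)) ⟩
    - (suc m · 1# + suc n · 1#)         ≡⟨ sym (-‿+-comm _ _) ⟩
    - (suc m · 1#) + - (suc n · 1#)     ∎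
  ⟦+⟧ -[1+ m ] (ℤ.+ n)   = trans (⟦⊖⟧ n (suc m)) (+-comm _ _)
  ⟦+⟧ (ℤ.+ m)  -[1+ n ]  = ⟦⊖⟧ m (suc n)
  ⟦+⟧ (ℤ.+ m)  (ℤ.+ n)   = ×-homo-+ 1# m n

  private
    ℤ-rawRing : RawRing _ _
    ℤ-rawRing = record { Carrier = ℤ ; _≈_ = _≡_ ; _+_ = ℤ._+_ ; _*_ = ℤ._*_ ; -_ = ℤ.-_ ; 0# = ℤ.+ 0 ; 1# = ℤ.+ 1 }

    ℤ⟶ring : ℤ-rawRing ACR.-Raw-AlmostCommutative⟶ ACR.fromCommutativeRing ring
    ℤ⟶ring = record { ⟦_⟧ = ⟦_⟧ ; +-homo = ⟦+⟧ ; *-homo = ⟦*⟧ ; -‿homo = ⟦-⟧ ; 0-homo = refl ; 1-homo = refl }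

    ⟦⟧-≟ : ∀ i j → Maybe (⟦ i ⟧ ≡ ⟦ j ⟧)
    ⟦⟧-≟ i j with i ℤ.≟ j
    ... | yes refl = just refl
    ... | no _     = nothing

    module Solver = Algebra.Solver.Ring ℤ-rawRing (ACR.fromCommutativeRing ring) ℤ⟶ring ⟦⟧-≟

  open Solver public using (solve; _:+_; _:*_; :-_; _:=_)

  :0# :1# : ∀ {n} → Solver.Polynomial n
  :0# = Solver.con (ℤ.+ 0)
  :1# = Solver.con (ℤ.+ 1)

module Removal {A : Set} (_≟_ : DecidableEquality A) where

  remove : A → List A → List A
  remove x = filter (λ y → ¬? (y ≟ x))

  remove-∉ : ∀ {x xs} → x ∉ xs → remove x xs ≡ xs
  remove-∉ x∉xs = filter-all (λ y → ¬? (y ≟ _)) (All.tabulate λ { y∈xs refl → x∉xs y∈xs })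

  length-remove-∈ : ∀ {x xs} → Unique xs → x ∈ xs → suc (length (remove x xs)) ≡ length xs
  length-remove-∈ {x} {y ∷ ys} (y∉ys ∷ _) (here refl) = begin
    suc (length (remove x (x ∷ ys)))  ≡⟨ cong (suc ∘ length) (filter-reject (λ y → ¬? (y ≟ x)) (λ x≢x → x≢x refl)) ⟩
    suc (length (remove x ys))        ≡⟨ cong (suc ∘ length) (remove-∉ (λ x∈ys → All.lookup y∉ys x∈ys refl)) ⟩
    suc (length ys)                   ∎
    where open ≡-Reasoning
  length-remove-∈ {x} {y ∷ ys} (y∉ys ∷ unique) (there x∈ys) = begin
    suc (length (remove x (y ∷ ys)))  ≡⟨ cong (suc ∘ length) (filter-accept (λ y → ¬? (y ≟ x)) (All.lookup y∉ys x∈ys)) ⟩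
    suc (suc (length (remove x ys)))  ≡⟨ cong suc (length-remove-∈ unique x∈ys) ⟩
    suc (length ys)                   ∎
    where open ≡-Reasoning

module _ {A B : Set} where

  mapWith∈-All : ∀ {P : B → Set} (xs : List A) {f : ∀ {x} → x ∈ xs → B} → (∀ {x} (x∈xs : x ∈ xs) → P (f x∈xs)) → All P (mapWith∈ xs f)
  mapWith∈-All []       _  = []
  mapWith∈-All (x ∷ xs) Pf = Pf (here refl) ∷ mapWith∈-All xs (Pf ∘ there)

  mapWith∈-AllPairs : ∀ {R : B → B → Set} {xs : List A} {f : ∀ {x} → x ∈ xs → B} → Unique xs →
                      (∀ {x y} (x∈xs : x ∈ xs) (y∈xs : y ∈ xs) → x ≢ y → R (f x∈xs) (f y∈xs)) →
                      AllPairs R (mapWith∈ xs f)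
  mapWith∈-AllPairs []             _    = []
  mapWith∈-AllPairs {R = R} {x ∷ xs} {f} (x∉xs ∷ unique) Rf =
    All.tabulate head-related ∷ mapWith∈-AllPairs unique (λ x∈ y∈ → Rf (there x∈) (there y∈))
    where
    head-related : ∀ {b} → b ∈ mapWith∈ xs (f ∘ there) → R (f (here refl)) b
    head-related b∈ with mapWith∈⁻ xs (f ∘ there) b∈
    ... | y , y∈xs , refl = Rf (here refl) (there y∈xs) (All.lookup x∉xs y∈xs)

module FieldFacts (F : FiniteField) where
  open FiniteField F public using (Carrier; _≟_; 0≢1; elements; elements-unique; elements-complete)
  open IntegerCoefficientSolver (FiniteField.isCommutativeRing F) public
    using (ring; solve; _:+_; _:*_; :-_; _:=_; :0#; :1#)
  open CommutativeRing ring public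
    using (_+_; _*_; -_; 0#; 1#; semiring; *-assoc; +-identityˡ; +-identityʳ; *-identityˡ; *-identityʳ; zeroˡ; zeroʳ)
  open ≡-Reasoning

  1≢0 : 1# ≢ 0#
  1≢0 = 0≢1 ∘ sym

  inv : ∀ x → x ≢ 0# → Carrier
  inv x x≢0 = proj₁ (FiniteField.inverse F x x≢0)

  *-inverseʳ : ∀ x (x≢0 : x ≢ 0#) → x * inv x x≢0 ≡ 1#
  *-inverseʳ x x≢0 = proj₂ (FiniteField.inverse F x x≢0)

  linear-root : ∀ {a x e} (a≢0 : a ≢ 0#) → a * x + e ≡ 0# → x ≡ - inv a a≢0 * e
  linear-root {a} {x} {e} a≢0 ax+e≡0 = begin
    x                                ≡⟨ sym (*-identityˡ x) ⟩
    1# * x                           ≡⟨ cong (_* x) (sym (*-inverseʳ a a≢0)) ⟩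
    a * a⁻¹ * x                      ≡⟨ solve 4 (λ a a⁻¹ x e → a :* a⁻¹ :* x := a⁻¹ :* (a :* x :+ e) :+ :- a⁻¹ :* e) refl a a⁻¹ x e ⟩
    a⁻¹ * (a * x + e) + - a⁻¹ * e    ≡⟨ cong (λ t → a⁻¹ * t + - a⁻¹ * e) ax+e≡0 ⟩
    a⁻¹ * 0# + - a⁻¹ * e             ≡⟨ solve 2 (λ a⁻¹ e → a⁻¹ :* :0# :+ :- a⁻¹ :* e := :- a⁻¹ :* e) refl a⁻¹ e ⟩
    - a⁻¹ * e                        ∎
    where a⁻¹ = inv a a≢0

  root-unique : ∀ {e b z} (z≢0 : z ≢ 0#) → e + b * z ≡ 0# → b ≡ - inv z z≢0 * e
  root-unique {e} {b} {z} z≢0 e+bz≡0 = linear-root z≢0 (trans (solve 3 (λ e b z → z :* b :+ e := e :+ b :* z) refl e b z) e+bz≡0)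

  root-correct : ∀ e {z} (z≢0 : z ≢ 0#) → e + - inv z z≢0 * e * z ≡ 0#
  root-correct e {z} z≢0 = begin
    e + - z⁻¹ * e * z         ≡⟨ solve 3 (λ e z z⁻¹ → e :+ :- z⁻¹ :* e :* z := e :+ :- (e :* (z :* z⁻¹))) refl e z z⁻¹ ⟩
    e + - (e * (z * z⁻¹))     ≡⟨ cong (λ t → e + - (e * t)) (*-inverseʳ z z≢0) ⟩
    e + - (e * 1#)            ≡⟨ solve 1 (λ e → e :+ :- (e :* :1#) := :0#) refl e ⟩
    0#                        ∎
    where z⁻¹ = inv z z≢0

  *-inv-cancelʳ : ∀ a {x} (x≢0 : x ≢ 0#) → a * x * inv x x≢0 ≡ a
  *-inv-cancelʳ a {x} x≢0 = trans (*-assoc a x _) (trans (cong (a *_) (*-inverseʳ x x≢0)) (*-identityʳ a))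

  *-inv-cancelˡ : ∀ {x} (x≢0 : x ≢ 0#) y → x * (y * inv x x≢0) ≡ y
  *-inv-cancelˡ {x} x≢0 y = trans (solve 3 (λ x y x⁻¹ → x :* (y :* x⁻¹) := y :* x :* x⁻¹) refl x y (inv x x≢0)) (*-inv-cancelʳ y x≢0)

  x-y≡0⇒x≡y : ∀ {x y} → x + - y ≡ 0# → x ≡ y
  x-y≡0⇒x≡y {x} {y} x-y≡0 = begin
    x             ≡⟨ solve 2 (λ x y → x := x :+ :- y :+ y) refl x y ⟩
    x + - y + y   ≡⟨ cong (_+ y) x-y≡0 ⟩
    0# + y        ≡⟨ +-identityˡ y ⟩
    y             ∎

  x≡y⇒x-y≡0 : ∀ {x y} → x ≡ y → x + - y ≡ 0#
  x≡y⇒x-y≡0 {x} refl = solve 1 (λ x → x :+ :- x := :0#) refl x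

  x*y≡0⇒y≡0 : ∀ {x y} → x ≢ 0# → x * y ≡ 0# → y ≡ 0#
  x*y≡0⇒y≡0 {x} {y} x≢0 xy≡0 = begin
    y                   ≡⟨ linear-root x≢0 (trans (+-identityʳ _) xy≡0) ⟩
    - inv x x≢0 * 0#    ≡⟨ zeroʳ _ ⟩
    0#                  ∎

  *-≢0 : ∀ {x y} → x ≢ 0# → y ≢ 0# → x * y ≢ 0#
  *-≢0 x≢0 y≢0 = y≢0 ∘ x*y≡0⇒y≡0 x≢0

  -‿≢0 : ∀ {x} → x ≢ 0# → - x ≢ 0#
  -‿≢0 {x} x≢0 -x≡0 = x≢0 (begin
    x               ≡⟨ solve 1 (λ x → x := :- (:- x)) refl x ⟩
    - (- x)         ≡⟨ cong -_ -x≡0 ⟩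
    - 0#            ≡⟨ solve 0 (:- :0# := :0#) refl ⟩
    0#              ∎)

module LinearAlgebra (F : FiniteField) where
  open FieldFacts F
  open Geometry F
  open import Algebra.Properties.Semiring.Sum semiring
    using (sum; sum-remove; ∑-comm; ∑-distrib-+; *-distribˡ-sum; *-distribʳ-sum; sum-cong-≗; sum-replicate-zero)
  open ≡-Reasoning

  sumFin≡sum : ∀ {k} (f : Fin k → Carrier) → sumFin f ≡ sum f
  sumFin≡sum {zero}  f = refl
  sumFin≡sum {suc k} f = cong (f zero +_) (sumFin≡sum (f ∘ suc))

  sum-zero : ∀ {k} {f : Fin k → Carrier} → (∀ i → f i ≡ 0#) → sum f ≡ 0#
  sum-zero {k} f≡0 = trans (sum-cong-≗ f≡0) (sum-replicate-zero k)

  lincomb-coord-zero : ∀ {k} (c : Fin k → Carrier) (g : Fin k → V) {j} → (∀ i → g i j ≡ 0#) → lincomb c g j ≡ 0#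
  lincomb-coord-zero c g {j} gⱼ≡0 = trans (sumFin≡sum (λ i → c i * g i j)) (sum-zero λ i → trans (cong (c i *_) (gⱼ≡0 i)) (zeroʳ _))

  lincomb-zero : ∀ {k} {c : Fin k → Carrier} (g : Fin k → V) j → (∀ i → c i ≡ 0#) → lincomb c g j ≡ 0#
  lincomb-zero {c = c} g j c≡0 = trans (sumFin≡sum (λ i → c i * g i j)) (sum-zero λ i → trans (cong (_* g i j) (c≡0 i)) (zeroˡ _))

  lincomb-cong : ∀ {k} {c d : Fin k → Carrier} (g : Fin k → V) j → (∀ i → c i ≡ d i) → lincomb c g j ≡ lincomb d g j
  lincomb-cong {c = c} {d} g j c≗d = trans (sumFin≡sum (λ i → c i * g i j))
    (trans (sum-cong-≗ (λ i → cong (_* g i j) (c≗d i))) (sym (sumFin≡sum (λ i → d i * g i j))))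

  scalar-zero : ∀ {a} {v : V} → NonZero v → (∀ j → a * v j ≡ 0#) → a ≡ 0#
  scalar-zero {a} v≢0 av≡0 with a ≟ 0#
  ... | yes a≡0 = a≡0
  ... | no  a≢0 = ⊥-elim (v≢0 (λ j → x*y≡0⇒y≡0 a≢0 (av≡0 j)))

  lincomb-scale : ∀ {k} a (c : Fin k → Carrier) (g : Fin k → V) j → lincomb (λ i → a * c i) g j ≡ a * lincomb c g j
  lincomb-scale {zero}  a c g j = sym (zeroʳ a)
  lincomb-scale {suc k} a c g j = begin
    a * c zero * g zero j + lincomb (λ i → a * c (suc i)) (g ∘ suc) j  ≡⟨ cong (a * c zero * g zero j +_) (lincomb-scale a (c ∘ suc) (g ∘ suc) j) ⟩
    a * c zero * g zero j + a * lincomb (c ∘ suc) (g ∘ suc) j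
      ≡⟨ solve 4 (λ a c g L → a :* c :* g :+ a :* L := a :* (c :* g :+ L)) refl a (c zero) (g zero j) _ ⟩
    a * (c zero * g zero j + lincomb (c ∘ suc) (g ∘ suc) j)            ∎

  lincomb-sub : ∀ {k} (c d : Fin k → Carrier) (g : Fin k → V) j →
                lincomb (λ i → c i + - d i) g j ≡ lincomb c g j + - lincomb d g j
  lincomb-sub {zero}  c d g j = solve 0 (:0# := :0# :+ :- :0#) refl
  lincomb-sub {suc k} c d g j = begin
    (c zero + - d zero) * g zero j + lincomb (λ i → c (suc i) + - d (suc i)) (g ∘ suc) j
      ≡⟨ cong ((c zero + - d zero) * g zero j +_) (lincomb-sub (c ∘ suc) (d ∘ suc) (g ∘ suc) j) ⟩
    (c zero + - d zero) * g zero j + (lincomb (c ∘ suc) (g ∘ suc) j + - lincomb (d ∘ suc) (g ∘ suc) j)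
      ≡⟨ solve 5 (λ c d g L M → (c :+ :- d) :* g :+ (L :+ :- M) := c :* g :+ L :+ :- (d :* g :+ M)) refl (c zero) (d zero) (g zero j) _ _ ⟩
    c zero * g zero j + lincomb (c ∘ suc) (g ∘ suc) j + - (d zero * g zero j + lincomb (d ∘ suc) (g ∘ suc) j)  ∎

  lincomb-∘ : ∀ {k m} {g : Fin k → V} {h : Fin m → V} (a : Fin k → Fin m → Carrier) →
              (∀ i j → g i j ≡ lincomb (a i) h j) →
              ∀ c j → lincomb c g j ≡ lincomb (λ t → sum (λ i → c i * a i t)) h j
  lincomb-∘ {k} {m} {g} {h} a g≡ah c j = begin
    lincomb c g j                                  ≡⟨ sumFin≡sum (λ i → c i * g i j) ⟩
    sum (λ i → c i * g i j)                        ≡⟨ sum-cong-≗ (λ i → cong (c i *_) (trans (g≡ah i j) (sumFin≡sum (λ t → a i t * h t j)))) ⟩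
    sum (λ i → c i * sum (λ t → a i t * h t j))    ≡⟨ sum-cong-≗ (λ i → *-distribˡ-sum (c i) (λ t → a i t * h t j)) ⟩
    sum (λ i → sum (λ t → c i * (a i t * h t j)))  ≡⟨ ∑-comm (λ i t → c i * (a i t * h t j)) ⟩
    sum (λ t → sum (λ i → c i * (a i t * h t j)))  ≡⟨ sum-cong-≗ (λ t → sum-cong-≗ (λ i → sym (*-assoc (c i) (a i t) (h t j)))) ⟩
    sum (λ t → sum (λ i → c i * a i t * h t j))    ≡⟨ sum-cong-≗ (λ t → sym (*-distribʳ-sum (h t j) (λ i → c i * a i t))) ⟩
    sum (λ t → sum (λ i → c i * a i t) * h t j)    ≡⟨ sym (sumFin≡sum (λ t → sum (λ i → c i * a i t) * h t j)) ⟩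
    lincomb (λ t → sum (λ i → c i * a i t)) h j    ∎

  ∈⟨⟩-trans : ∀ {k m} {g : Fin k → V} {h : Fin m → V} → (∀ i → g i ∈⟨ h ⟩) → ∀ {v} → v ∈⟨ g ⟩ → v ∈⟨ h ⟩
  ∈⟨⟩-trans g⊆h (c , v≡cg) = _ , λ j → trans (v≡cg j) (lincomb-∘ (proj₁ ∘ g⊆h) (proj₂ ∘ g⊆h) c j)

  ∈⟨⟩-resp : ∀ {k v v′} {g : Fin k → V} → (∀ j → v j ≡ v′ j) → v ∈⟨ g ⟩ → v′ ∈⟨ g ⟩
  ∈⟨⟩-resp v≗v′ (c , v≗cg) = c , λ j → trans (sym (v≗v′ j)) (v≗cg j)

  ∈⟨⟩-gen : ∀ {k} (g : Fin (suc k) → V) i → g i ∈⟨ g ⟩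
  ∈⟨⟩-gen g i = eᵢ , λ j → sym (begin
    lincomb eᵢ g j                                                ≡⟨ sumFin≡sum (λ t → eᵢ t * g t j) ⟩
    sum (λ t → eᵢ t * g t j)                                      ≡⟨ sum-remove {i = i} (λ t → eᵢ t * g t j) ⟩
    eᵢ i * g i j + sum (λ t → eᵢ (punchIn i t) * g (punchIn i t) j)
      ≡⟨ cong₂ (λ a b → a * g i j + b) (insertAt-lookup _ i 1#) (sum-zero (λ t → trans (cong (_* _) (insertAt-punchIn _ i 1# t)) (zeroˡ _))) ⟩
    1# * g i j + 0#                                               ≡⟨ solve 1 (λ x → :1# :* x :+ :0# := x) refl (g i j) ⟩
    g i j                                                         ∎)
    where eᵢ = insertAt (λ _ → 0#) i 1#

  Nontrivial : ∀ {k} → (Fin k → Carrier) → Set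
  Nontrivial c = ∃ λ i → c i ≢ 0#

  eliminate : ∀ {n k} (g : Fin (suc k) → Fin (suc n) → Carrier) i₀ → g i₀ zero ≢ 0# → Fin k → Fin (suc n) → Carrier
  eliminate g i₀ a≢0 i j = g (punchIn i₀ i) j + - (g (punchIn i₀ i) zero * inv (g i₀ zero) a≢0 * g i₀ j)

  eliminate-column₀ : ∀ {n k} (g : Fin (suc k) → Fin (suc n) → Carrier) i₀ (a≢0 : g i₀ zero ≢ 0#) i →
                      eliminate g i₀ a≢0 i zero ≡ 0#
  eliminate-column₀ g i₀ a≢0 i = begin
    x + - (x * a⁻¹ * a)      ≡⟨ solve 3 (λ x a a⁻¹ → x :+ :- (x :* a⁻¹ :* a) := x :+ :- (x :* (a :* a⁻¹))) refl x a a⁻¹ ⟩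
    x + - (x * (a * a⁻¹))    ≡⟨ cong (λ t → x + - (x * t)) (*-inverseʳ a a≢0) ⟩
    x + - (x * 1#)           ≡⟨ solve 1 (λ x → x :+ :- (x :* :1#) := :0#) refl x ⟩
    0#                       ∎
    where
    a = g i₀ zero
    a⁻¹ = inv a a≢0
    x = g (punchIn i₀ i) zero

  lift-relation : ∀ {n k} (g : Fin (suc k) → Fin (suc n) → Carrier) i₀ (a≢0 : g i₀ zero ≢ 0#) (d : Fin k → Carrier) j →
                  sum (λ i → insertAt d i₀ (sum (λ i → d i * - (g (punchIn i₀ i) zero * inv (g i₀ zero) a≢0))) i * g i j)
                  ≡ sum (λ i → d i * eliminate g i₀ a≢0 i j)
  lift-relation g i₀ a≢0 d j = begin
    sum (λ i → c i * g i j)                                         ≡⟨ sum-remove {i = i₀} (λ i → c i * g i j) ⟩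
    c i₀ * g i₀ j + sum (λ i → c (punchIn i₀ i) * g′ i j)
      ≡⟨ cong₂ (λ x y → x * g i₀ j + y) (insertAt-lookup d i₀ _) (sum-cong-≗ (λ i → cong (_* g′ i j) (insertAt-punchIn d i₀ _ i))) ⟩
    sum (λ i → d i * - f i) * g i₀ j + sum (λ i → d i * g′ i j)
      ≡⟨ cong (_+ sum (λ i → d i * g′ i j)) (*-distribʳ-sum (g i₀ j) (λ i → d i * - f i)) ⟩
    sum (λ i → d i * - f i * g i₀ j) + sum (λ i → d i * g′ i j)     ≡⟨ sym (∑-distrib-+ (λ i → d i * - f i * g i₀ j) (λ i → d i * g′ i j)) ⟩
    sum (λ i → d i * - f i * g i₀ j + d i * g′ i j)
      ≡⟨ sum-cong-≗ (λ i → solve 4 (λ d f G x → d :* :- f :* G :+ d :* x := d :* (x :+ :- (f :* G))) refl (d i) (f i) (g i₀ j) (g′ i j)) ⟩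
    sum (λ i → d i * eliminate g i₀ a≢0 i j)                        ∎
    where
    g′ = λ i → g (punchIn i₀ i)
    f = λ i → g′ i zero * inv (g i₀ zero) a≢0
    c = insertAt d i₀ (sum (λ i → d i * - f i))

  -- Gaussian elimination on the first coordinate.
  dependent : ∀ {n k} → n ℕ.< k → (g : Fin k → Fin n → Carrier) →
              Σ (Fin k → Carrier) λ c → Nontrivial c × (∀ j → sum (λ i → c i * g i j) ≡ 0#)
  dependent {zero}  {suc k} _ g = (λ _ → 1#) , (zero , 1≢0) , λ ()
  dependent {suc n} {suc k} (s≤s n<k) g with Fin.all? (λ i → g i zero ≟ 0#)
  ... | yes column₀≡0 =
    let c , c≢0 , relation = dependent (ℕ.m≤n⇒m≤1+n n<k) (λ i j → g i (suc j))
    in c , c≢0 , λ { zero → sum-zero (λ i → trans (cong (c i *_) (column₀≡0 i)) (zeroʳ _)) ; (suc j) → relation j }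
  ... | no column₀≢0 with Fin.¬∀⟶∃¬ _ _ (λ i → g i zero ≟ 0#) column₀≢0
  ...   | i₀ , a≢0 with dependent n<k (λ i j → eliminate g i₀ a≢0 i (suc j))
  ...     | d , (i₁ , dᵢ₁≢0) , relation =
    insertAt d i₀ _ , (punchIn i₀ i₁ , dᵢ₁≢0 ∘ trans (sym (insertAt-punchIn d i₀ _ i₁))) , λ
      { zero    → trans (lift-relation g i₀ a≢0 d zero) (sum-zero (λ i → trans (cong (d i *_) (eliminate-column₀ g i₀ a≢0 i)) (zeroʳ _)))
      ; (suc j) → trans (lift-relation g i₀ a≢0 d (suc j)) (relation j) }

  LinearlyClosed : (V → Set) → Set
  LinearlyClosed W = ∀ {k} (c : Fin k → Carrier) (g : Fin k → V) → (∀ i → W (g i)) → W (lincomb c g)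

  DeterminedBy : (V → Set) → ∀ {n} → (Fin n → Fin 6) → Set
  DeterminedBy W sel = ∀ y → W y → (∀ j → y (sel j) ≡ 0#) → IsZero y

  dependent-within : ∀ {W n k} (sel : Fin n → Fin 6) → LinearlyClosed W → DeterminedBy W sel → n ℕ.< k →
                     (g : Fin k → V) → (∀ i → W (g i)) → Σ (Fin k → Carrier) λ c → Nontrivial c × IsZero (lincomb c g)
  dependent-within sel closed determined n<k g g∈W =
    let c , c≢0 , relation = dependent n<k (λ i j → g i (sel j))
    in c , c≢0 , determined (lincomb c g) (closed c g g∈W) (λ j → trans (sumFin≡sum (λ i → c i * g i (sel j))) (relation j))

  dependent-in-span : ∀ {n k} (h : Fin n → V) → n ℕ.< k → (g : Fin k → V) → (∀ i → g i ∈⟨ h ⟩) →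
                      Σ (Fin k → Carrier) λ c → Nontrivial c × IsZero (lincomb c g)
  dependent-in-span h n<k g g⊆h =
    let c , c≢0 , relation = dependent n<k (proj₁ ∘ g⊆h)
    in c , c≢0 , λ j → trans (lincomb-∘ (proj₁ ∘ g⊆h) (proj₂ ∘ g⊆h) c j) (lincomb-zero h j relation)

  ∈⟨⟩-of-relation : ∀ {k p a} {g : Fin k → V} (c : Fin k → Carrier) → a ≢ 0# →
                    (∀ j → a * p j + lincomb c g j ≡ 0#) → p ∈⟨ g ⟩
  ∈⟨⟩-of-relation {a = a} {g} c a≢0 relation =
    (λ i → - inv a a≢0 * c i) , λ j → trans (linear-root a≢0 (relation j)) (sym (lincomb-scale _ c g j))

  lincomb-tail : ∀ {k p} {g : Fin k → V} (c : Fin (suc k) → Carrier) → c zero ≡ 0# →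
                 ∀ j → lincomb c (p ∷ᵥ g) j ≡ lincomb (c ∘ suc) g j
  lincomb-tail {p = p} {g} c c₀≡0 j =
    trans (cong (λ t → t * p j + lincomb (c ∘ suc) g j) c₀≡0) (solve 2 (λ p L → :0# :* p :+ L := L) refl (p j) (lincomb (c ∘ suc) g j))

  ∷-linIndep : ∀ {k p} {g : Fin k → V} → LinIndep g → ¬ (p ∈⟨ g ⟩) → LinIndep (p ∷ᵥ g)
  ∷-linIndep {p = p} {g} indep p∉g c z with c zero ≟ 0#
  ... | no  c₀≢0 = ⊥-elim (p∉g (∈⟨⟩-of-relation (c ∘ suc) c₀≢0 z))
  ... | yes c₀≡0 = λ { zero → c₀≡0 ; (suc i) → indep (c ∘ suc) (λ j → trans (sym (lincomb-tail {p = p} {g = g} c c₀≡0 j)) (z j)) i }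

  ∈⟨⟩-of-nontrivial-relation : ∀ {k y} {g : Fin k → V} → LinIndep g → (c : Fin (suc k) → Carrier) →
                               Nontrivial c → IsZero (lincomb c (y ∷ᵥ g)) → y ∈⟨ g ⟩
  ∈⟨⟩-of-nontrivial-relation {y = y} {g} indep c (i₁ , cᵢ₁≢0) z with c zero ≟ 0#
  ... | no  c₀≢0 = ∈⟨⟩-of-relation (c ∘ suc) c₀≢0 z
  ... | yes c₀≡0 = ⊥-elim (cᵢ₁≢0 (c≡0 i₁))
    where
    c≡0 : ∀ i → c i ≡ 0#
    c≡0 zero    = c₀≡0
    c≡0 (suc i) = indep (c ∘ suc) (λ j → trans (sym (lincomb-tail {p = y} {g = g} c c₀≡0 j)) (z j)) i

  -- Opaque: the coefficients come out of Gaussian elimination, and letting the type checker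
  -- unfold them downstream is prohibitively slow.
  opaque
    ∈⟨⟩-of-independent-within : ∀ {W n} (sel : Fin n → Fin 6) → LinearlyClosed W → DeterminedBy W sel →
                                (g : Fin n → V) → LinIndep g → (∀ i → W (g i)) → ∀ y → W y → y ∈⟨ g ⟩
    ∈⟨⟩-of-independent-within sel closed determined g indep g∈W y y∈W =
      let c , c≢0 , z = dependent-within sel closed determined ℕ.≤-refl (y ∷ᵥ g) (λ { zero → y∈W ; (suc i) → g∈W i })
      in ∈⟨⟩-of-nontrivial-relation indep c c≢0 z

    ∈⟨⟩-of-independent-in-span : ∀ {n} (h g : Fin n → V) → LinIndep g → (∀ i → g i ∈⟨ h ⟩) → ∀ y → y ∈⟨ h ⟩ → y ∈⟨ g ⟩
    ∈⟨⟩-of-independent-in-span h g indep g⊆h y y∈h =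
      let c , c≢0 , z = dependent-in-span h ℕ.≤-refl (y ∷ᵥ g) (λ { zero → y∈h ; (suc i) → g⊆h i })
      in ∈⟨⟩-of-nontrivial-relation indep c c≢0 z

  lincomb-injective : ∀ {k} {g : Fin k → V} → LinIndep g → ∀ c d → (∀ j → lincomb c g j ≡ lincomb d g j) → ∀ i → c i ≡ d i
  lincomb-injective {g = g} indep c d c≡d i = x-y≡0⇒x≡y (indep (λ i → c i + - d i) (λ j → trans (lincomb-sub c d g j) (x≡y⇒x-y≡0 (c≡d j))) i)

module Symplectic (F : FiniteField) where
  open FieldFacts F
  open Geometry F
  open LinearAlgebra F
  open ≡-Reasoning

  B-cong : ∀ {x x′ y y′ : V} → (∀ j → x j ≡ x′ j) → (∀ j → y j ≡ y′ j) → B x y ≡ B x′ y′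
  B-cong x≗x′ y≗y′ = cong₂ _+_ (pair (# 0) (# 3)) (cong₂ _+_ (pair (# 1) (# 4)) (pair (# 2) (# 5)))
    where pair = λ i j → cong₂ (λ s t → s + - t) (cong₂ _*_ (x≗x′ i) (y≗y′ j)) (cong₂ _*_ (x≗x′ j) (y≗y′ i))

  B-alternating : ∀ x → B x x ≡ 0#
  B-alternating x = solve 6 (λ x₀ x₁ x₂ x₃ x₄ x₅ →
      x₀ :* x₃ :+ :- (x₃ :* x₀) :+ (x₁ :* x₄ :+ :- (x₄ :* x₁) :+ (x₂ :* x₅ :+ :- (x₅ :* x₂))) := :0#)
    refl (x (# 0)) (x (# 1)) (x (# 2)) (x (# 3)) (x (# 4)) (x (# 5))

  B-linearʳ : ∀ x y z a → B x (λ j → a * y j + z j) ≡ a * B x y + B x z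
  B-linearʳ x y z a = solve 19 (λ x₀ x₁ x₂ x₃ x₄ x₅ y₀ y₁ y₂ y₃ y₄ y₅ z₀ z₁ z₂ z₃ z₄ z₅ a →
      x₀ :* (a :* y₃ :+ z₃) :+ :- (x₃ :* (a :* y₀ :+ z₀))
        :+ (x₁ :* (a :* y₄ :+ z₄) :+ :- (x₄ :* (a :* y₁ :+ z₁)) :+ (x₂ :* (a :* y₅ :+ z₅) :+ :- (x₅ :* (a :* y₂ :+ z₂))))
      := a :* (x₀ :* y₃ :+ :- (x₃ :* y₀) :+ (x₁ :* y₄ :+ :- (x₄ :* y₁) :+ (x₂ :* y₅ :+ :- (x₅ :* y₂))))
           :+ (x₀ :* z₃ :+ :- (x₃ :* z₀) :+ (x₁ :* z₄ :+ :- (x₄ :* z₁) :+ (x₂ :* z₅ :+ :- (x₅ :* z₂)))))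
    refl (x (# 0)) (x (# 1)) (x (# 2)) (x (# 3)) (x (# 4)) (x (# 5))
         (y (# 0)) (y (# 1)) (y (# 2)) (y (# 3)) (y (# 4)) (y (# 5))
         (z (# 0)) (z (# 1)) (z (# 2)) (z (# 3)) (z (# 4)) (z (# 5)) a

  B-scaleˡ : ∀ x y a → B (λ j → a * x j) y ≡ a * B x y
  B-scaleˡ x y a = solve 13 (λ x₀ x₁ x₂ x₃ x₄ x₅ y₀ y₁ y₂ y₃ y₄ y₅ a →
      a :* x₀ :* y₃ :+ :- (a :* x₃ :* y₀) :+ (a :* x₁ :* y₄ :+ :- (a :* x₄ :* y₁) :+ (a :* x₂ :* y₅ :+ :- (a :* x₅ :* y₂)))
      := a :* (x₀ :* y₃ :+ :- (x₃ :* y₀) :+ (x₁ :* y₄ :+ :- (x₄ :* y₁) :+ (x₂ :* y₅ :+ :- (x₅ :* y₂)))))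
    refl (x (# 0)) (x (# 1)) (x (# 2)) (x (# 3)) (x (# 4)) (x (# 5))
         (y (# 0)) (y (# 1)) (y (# 2)) (y (# 3)) (y (# 4)) (y (# 5)) a

  B-bilinear : ∀ u w a b c d → B (λ j → a * u j + b * w j) (λ j → c * u j + d * w j) ≡ (a * d + - (b * c)) * B u w
  B-bilinear u w a b c d = solve 16 (λ u₀ u₁ u₂ u₃ u₄ u₅ w₀ w₁ w₂ w₃ w₄ w₅ a b c d →
      let x = λ u w → a :* u :+ b :* w
          y = λ u w → c :* u :+ d :* w
      in x u₀ w₀ :* y u₃ w₃ :+ :- (x u₃ w₃ :* y u₀ w₀)
           :+ (x u₁ w₁ :* y u₄ w₄ :+ :- (x u₄ w₄ :* y u₁ w₁) :+ (x u₂ w₂ :* y u₅ w₅ :+ :- (x u₅ w₅ :* y u₂ w₂)))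
         := (a :* d :+ :- (b :* c)) :* (u₀ :* w₃ :+ :- (u₃ :* w₀) :+ (u₁ :* w₄ :+ :- (u₄ :* w₁) :+ (u₂ :* w₅ :+ :- (u₅ :* w₂)))))
    refl (u (# 0)) (u (# 1)) (u (# 2)) (u (# 3)) (u (# 4)) (u (# 5))
         (w (# 0)) (w (# 1)) (w (# 2)) (w (# 3)) (w (# 4)) (w (# 5)) a b c d

  ⊥-linearlyClosed : ∀ x → LinearlyClosed (λ y → B x y ≡ 0#)
  ⊥-linearlyClosed x {ℕ.zero} c g _ = solve 6 (λ x₀ x₁ x₂ x₃ x₄ x₅ →
      x₀ :* :0# :+ :- (x₃ :* :0#) :+ (x₁ :* :0# :+ :- (x₄ :* :0#) :+ (x₂ :* :0# :+ :- (x₅ :* :0#))) := :0#)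
    refl (x (# 0)) (x (# 1)) (x (# 2)) (x (# 3)) (x (# 4)) (x (# 5))
  ⊥-linearlyClosed x {ℕ.suc k} c g g⊥x = begin
    B x (λ j → c zero * g zero j + lincomb (c ∘ suc) (g ∘ suc) j)        ≡⟨ B-linearʳ x (g zero) (lincomb (c ∘ suc) (g ∘ suc)) (c zero) ⟩
    c zero * B x (g zero) + B x (lincomb (c ∘ suc) (g ∘ suc))
      ≡⟨ cong₂ (λ s t → c zero * s + t) (g⊥x zero) (⊥-linearlyClosed x (c ∘ suc) (g ∘ suc) (g⊥x ∘ suc)) ⟩
    c zero * 0# + 0#                                                     ≡⟨ solve 1 (λ c → c :* :0# :+ :0# := :0#) refl (c zero) ⟩
    0#                                                                   ∎

  ∈⟨⟩-⊥ : ∀ {k x v} {g : Fin k → V} → (∀ i → B x (g i) ≡ 0#) → v ∈⟨ g ⟩ → B x v ≡ 0#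
  ∈⟨⟩-⊥ {x = x} {g = g} g⊥x (c , v≗cg) = trans (B-cong {x} (λ _ → refl) v≗cg) (⊥-linearlyClosed x c g g⊥x)

module Coordinates (F : FiniteField) where
  open FieldFacts F
  open Geometry F
  open LinearAlgebra F

  vec₂ vec₁ : Carrier → Carrier → Carrier → V
  vec₂ a b c zero                = a
  vec₂ a b c (suc zero)          = b
  vec₂ a b c (suc (suc zero))    = c
  vec₂ a b c (suc (suc (suc _))) = 0#
  vec₁ a b c (suc (suc (suc zero)))             = a
  vec₁ a b c (suc (suc (suc (suc zero))))       = b
  vec₁ a b c (suc (suc (suc (suc (suc zero))))) = c
  vec₁ a b c _                                  = 0#

  InΠ₁ InΠ₂ : V → Set
  InΠ₁ v = v (# 0) ≡ 0# × v (# 1) ≡ 0# × v (# 2) ≡ 0#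
  InΠ₂ v = v (# 3) ≡ 0# × v (# 4) ≡ 0# × v (# 5) ≡ 0#

  private
    pick₀ : ∀ a b c → a * 1# + (b * 0# + (c * 0# + 0#)) ≡ a
    pick₀ = solve 3 (λ a b c → a :* :1# :+ (b :* :0# :+ (c :* :0# :+ :0#)) := a) refl
    pick₁ : ∀ a b c → a * 0# + (b * 1# + (c * 0# + 0#)) ≡ b
    pick₁ = solve 3 (λ a b c → a :* :0# :+ (b :* :1# :+ (c :* :0# :+ :0#)) := b) refl
    pick₂ : ∀ a b c → a * 0# + (b * 0# + (c * 1# + 0#)) ≡ c
    pick₂ = solve 3 (λ a b c → a :* :0# :+ (b :* :0# :+ (c :* :1# :+ :0#)) := c) refl
    pick∅ : ∀ a b c → a * 0# + (b * 0# + (c * 0# + 0#)) ≡ 0#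
    pick∅ = solve 3 (λ a b c → a :* :0# :+ (b :* :0# :+ (c :* :0# :+ :0#)) := :0#) refl

  lincomb-Π₂ : ∀ c j → lincomb c Π₂ j ≡ vec₂ (c (# 0)) (c (# 1)) (c (# 2)) j
  lincomb-Π₂ c zero                                = pick₀ (c (# 0)) (c (# 1)) (c (# 2))
  lincomb-Π₂ c (suc zero)                          = pick₁ (c (# 0)) (c (# 1)) (c (# 2))
  lincomb-Π₂ c (suc (suc zero))                    = pick₂ (c (# 0)) (c (# 1)) (c (# 2))
  lincomb-Π₂ c (suc (suc (suc zero)))              = pick∅ (c (# 0)) (c (# 1)) (c (# 2))
  lincomb-Π₂ c (suc (suc (suc (suc zero))))        = pick∅ (c (# 0)) (c (# 1)) (c (# 2))
  lincomb-Π₂ c (suc (suc (suc (suc (suc zero))))) = pick∅ (c (# 0)) (c (# 1)) (c (# 2))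

  lincomb-Π₁ : ∀ c j → lincomb c Π₁ j ≡ vec₁ (c (# 0)) (c (# 1)) (c (# 2)) j
  lincomb-Π₁ c zero                                = pick∅ (c (# 0)) (c (# 1)) (c (# 2))
  lincomb-Π₁ c (suc zero)                          = pick∅ (c (# 0)) (c (# 1)) (c (# 2))
  lincomb-Π₁ c (suc (suc zero))                    = pick∅ (c (# 0)) (c (# 1)) (c (# 2))
  lincomb-Π₁ c (suc (suc (suc zero)))              = pick₀ (c (# 0)) (c (# 1)) (c (# 2))
  lincomb-Π₁ c (suc (suc (suc (suc zero))))        = pick₁ (c (# 0)) (c (# 1)) (c (# 2))
  lincomb-Π₁ c (suc (suc (suc (suc (suc zero))))) = pick₂ (c (# 0)) (c (# 1)) (c (# 2))

  ∈Π₂⇒InΠ₂ : ∀ {v} → v ∈⟨ Π₂ ⟩ → InΠ₂ v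
  ∈Π₂⇒InΠ₂ (c , v≗) = trans (v≗ (# 3)) (lincomb-Π₂ c (# 3)) , trans (v≗ (# 4)) (lincomb-Π₂ c (# 4)) , trans (v≗ (# 5)) (lincomb-Π₂ c (# 5))

  ∈Π₁⇒InΠ₁ : ∀ {v} → v ∈⟨ Π₁ ⟩ → InΠ₁ v
  ∈Π₁⇒InΠ₁ (c , v≗) = trans (v≗ (# 0)) (lincomb-Π₁ c (# 0)) , trans (v≗ (# 1)) (lincomb-Π₁ c (# 1)) , trans (v≗ (# 2)) (lincomb-Π₁ c (# 2))

  InΠ₂⇒∈Π₂ : ∀ {v} → InΠ₂ v → v ∈⟨ Π₂ ⟩
  InΠ₂⇒∈Π₂ {v} (v₃≡0 , v₄≡0 , v₅≡0) = c , λ j → trans (v≗vec₂ j) (sym (lincomb-Π₂ c j))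
    where
    c = v (# 0) ∷ᵥ v (# 1) ∷ᵥ v (# 2) ∷ᵥ []ᵥ
    v≗vec₂ : ∀ j → v j ≡ vec₂ (v (# 0)) (v (# 1)) (v (# 2)) j
    v≗vec₂ zero                                = refl
    v≗vec₂ (suc zero)                          = refl
    v≗vec₂ (suc (suc zero))                    = refl
    v≗vec₂ (suc (suc (suc zero)))              = v₃≡0
    v≗vec₂ (suc (suc (suc (suc zero))))        = v₄≡0
    v≗vec₂ (suc (suc (suc (suc (suc zero))))) = v₅≡0

  InΠ₁⇒∈Π₁ : ∀ {v} → InΠ₁ v → v ∈⟨ Π₁ ⟩
  InΠ₁⇒∈Π₁ {v} (v₀≡0 , v₁≡0 , v₂≡0) = c , λ j → trans (v≗vec₁ j) (sym (lincomb-Π₁ c j))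
    where
    c = v (# 3) ∷ᵥ v (# 4) ∷ᵥ v (# 5) ∷ᵥ []ᵥ
    v≗vec₁ : ∀ j → v j ≡ vec₁ (v (# 3)) (v (# 4)) (v (# 5)) j
    v≗vec₁ zero                                = v₀≡0
    v≗vec₁ (suc zero)                          = v₁≡0
    v≗vec₁ (suc (suc zero))                    = v₂≡0
    v≗vec₁ (suc (suc (suc zero)))              = refl
    v≗vec₁ (suc (suc (suc (suc zero))))        = refl
    v≗vec₁ (suc (suc (suc (suc (suc zero))))) = refl

  InΠ₁-linearlyClosed : LinearlyClosed InΠ₁
  InΠ₁-linearlyClosed c g g∈Π₁ = lincomb-coord-zero c g (proj₁ ∘ g∈Π₁)
                               , lincomb-coord-zero c g (proj₁ ∘ proj₂ ∘ g∈Π₁)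
                               , lincomb-coord-zero c g (proj₂ ∘ proj₂ ∘ g∈Π₁)

  coordinatewise : (Q : Fin 6 → Set) → Q (# 0) → Q (# 1) → Q (# 2) → Q (# 3) → Q (# 4) → Q (# 5) → ∀ j → Q j
  coordinatewise Q q₀ q₁ q₂ q₃ q₄ q₅ = λ
    { zero → q₀ ; (suc zero) → q₁ ; (suc (suc zero)) → q₂
    ; (suc (suc (suc zero))) → q₃ ; (suc (suc (suc (suc zero)))) → q₄ ; (suc (suc (suc (suc (suc zero))))) → q₅ }

  Π₁Π₂-linIndep : ∀ {u w} → NonZero u → NonZero w → InΠ₁ u → InΠ₂ w → LinIndep (u ∷ᵥ w ∷ᵥ []ᵥ)
  Π₁Π₂-linIndep {u} {w} u≢0 w≢0 (u₀ , u₁ , u₂) (w₃ , w₄ , w₅) c z = λ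
    { zero       → scalar-zero u≢0 (coordinatewise (λ j → a * u j ≡ 0#)
                     (kill-u u₀) (kill-u u₁) (kill-u u₂) (only-u w₃) (only-u w₄) (only-u w₅))
    ; (suc zero) → scalar-zero w≢0 (coordinatewise (λ j → b * w j ≡ 0#)
                     (only-w u₀) (only-w u₁) (only-w u₂) (kill-w w₃) (kill-w w₄) (kill-w w₅)) }
    where
    a = c zero
    b = c (suc zero)
    kill-u : ∀ {j} → u j ≡ 0# → a * u j ≡ 0#
    kill-u u≡0 = trans (cong (a *_) u≡0) (zeroʳ a)
    kill-w : ∀ {j} → w j ≡ 0# → b * w j ≡ 0#
    kill-w w≡0 = trans (cong (b *_) w≡0) (zeroʳ b)
    only-u : ∀ {j} → w j ≡ 0# → a * u j ≡ 0#
    only-u {j} w≡0 = trans (sym (trans (cong (λ t → a * u j + (t + 0#)) (kill-w w≡0))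
                                       (solve 1 (λ x → x :+ (:0# :+ :0#) := x) refl (a * u j)))) (z j)
    only-w : ∀ {j} → u j ≡ 0# → b * w j ≡ 0#
    only-w {j} u≡0 = trans (sym (trans (cong (λ t → t + (b * w j + 0#)) (kill-u u≡0))
                                       (solve 1 (λ y → :0# :+ (y :+ :0#) := y) refl (b * w j)))) (z j)

module PointsOfΠ₂ (F : FiniteField) where
  open FieldFacts F
  open Geometry F
  open LinearAlgebra F
  open Symplectic F
  open Coordinates F
  open ≡-Reasoning

  vec′ : Pt₂ → V
  vec′ (pA a b) = vec₂ 1# a b
  vec′ (pB b)   = vec₂ 0# 1# b
  vec′ pC       = vec₂ 0# 0# 1#

  vec≗vec′ : ∀ P j → vec P j ≡ vec′ P j
  vec≗vec′ (pA a b) = lincomb-Π₂ (1# ∷ᵥ a ∷ᵥ b ∷ᵥ []ᵥ)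
  vec≗vec′ (pB b)   = lincomb-Π₂ (0# ∷ᵥ 1# ∷ᵥ b ∷ᵥ []ᵥ)
  vec≗vec′ pC       = lincomb-Π₂ (0# ∷ᵥ 0# ∷ᵥ 1# ∷ᵥ []ᵥ)

  vec-InΠ₂ : ∀ P → InΠ₂ (vec P)
  vec-InΠ₂ (pA a b) = vec≗vec′ (pA a b) (# 3) , vec≗vec′ (pA a b) (# 4) , vec≗vec′ (pA a b) (# 5)
  vec-InΠ₂ (pB b)   = vec≗vec′ (pB b) (# 3) , vec≗vec′ (pB b) (# 4) , vec≗vec′ (pB b) (# 5)
  vec-InΠ₂ pC       = vec≗vec′ pC (# 3) , vec≗vec′ pC (# 4) , vec≗vec′ pC (# 5)

  vec-¬InΠ₁ : ∀ P → ¬ InΠ₁ (vec P)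
  vec-¬InΠ₁ (pA a b) (v₀≡0 , _)         = 1≢0 (trans (sym (vec≗vec′ (pA a b) (# 0))) v₀≡0)
  vec-¬InΠ₁ (pB b)   (_ , v₁≡0 , _)     = 1≢0 (trans (sym (vec≗vec′ (pB b) (# 1))) v₁≡0)
  vec-¬InΠ₁ pC       (_ , _ , v₂≡0)     = 1≢0 (trans (sym (vec≗vec′ pC (# 2))) v₂≡0)

  dot : Pt₂ → Carrier → Carrier → Carrier → Carrier
  dot (pA a b) x y z = x + a * y + b * z
  dot (pB b)   x y z = y + b * z
  dot pC       x y z = z

  B-vec : ∀ P y → B (vec P) y ≡ dot P (y (# 3)) (y (# 4)) (y (# 5))
  B-vec P y = trans (B-cong {y = y} (vec≗vec′ P) (λ _ → refl)) (B-vec′ P)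
    where
    B-vec′ : ∀ P → B (vec′ P) y ≡ dot P (y (# 3)) (y (# 4)) (y (# 5))
    B-vec′ (pA a b) = solve 8 (λ y₀ y₁ y₂ y₃ y₄ y₅ a b →
      :1# :* y₃ :+ :- (:0# :* y₀) :+ (a :* y₄ :+ :- (:0# :* y₁) :+ (b :* y₅ :+ :- (:0# :* y₂))) := y₃ :+ a :* y₄ :+ b :* y₅)
      refl (y (# 0)) (y (# 1)) (y (# 2)) (y (# 3)) (y (# 4)) (y (# 5)) a b
    B-vec′ (pB b) = solve 7 (λ y₀ y₁ y₂ y₃ y₄ y₅ b →
      :0# :* y₃ :+ :- (:0# :* y₀) :+ (:1# :* y₄ :+ :- (:0# :* y₁) :+ (b :* y₅ :+ :- (:0# :* y₂))) := y₄ :+ b :* y₅)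
      refl (y (# 0)) (y (# 1)) (y (# 2)) (y (# 3)) (y (# 4)) (y (# 5)) b
    B-vec′ pC = solve 6 (λ y₀ y₁ y₂ y₃ y₄ y₅ →
      :0# :* y₃ :+ :- (:0# :* y₀) :+ (:0# :* y₄ :+ :- (:0# :* y₁) :+ (:1# :* y₅ :+ :- (:0# :* y₂))) := y₅)
      refl (y (# 0)) (y (# 1)) (y (# 2)) (y (# 3)) (y (# 4)) (y (# 5))

  pivot′ : Pt₂ → Fin 3
  pivot′ (pA _ _) = # 0
  pivot′ (pB _)   = # 1
  pivot′ pC       = # 2

  pivot : Pt₂ → Fin 6
  pivot P = suc (suc (suc (pivot′ P)))

  dot-at-pivot : ∀ P (y : V) → (∀ j → pivot P ≢ j → y j ≡ 0#) → dot P (y (# 3)) (y (# 4)) (y (# 5)) ≡ y (pivot P)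
  dot-at-pivot (pA a b) y off = begin
    y (# 3) + a * y (# 4) + b * y (# 5)   ≡⟨ cong₂ (λ s t → y (# 3) + a * s + b * t) (off (# 4) (λ ())) (off (# 5) (λ ())) ⟩
    y (# 3) + a * 0# + b * 0#             ≡⟨ solve 3 (λ y a b → y :+ a :* :0# :+ b :* :0# := y) refl (y (# 3)) a b ⟩
    y (# 3)                               ∎
  dot-at-pivot (pB b) y off = begin
    y (# 4) + b * y (# 5)                 ≡⟨ cong (λ t → y (# 4) + b * t) (off (# 5) (λ ())) ⟩
    y (# 4) + b * 0#                      ≡⟨ solve 2 (λ y b → y :+ b :* :0# := y) refl (y (# 4)) b ⟩
    y (# 4)                               ∎
  dot-at-pivot pC y off = refl

  ⊥-determined : ∀ P → DeterminedBy (λ y → B (vec P) y ≡ 0#) (punchIn (pivot P))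
  ⊥-determined P y y⊥P y-off = y≡0
    where
    off : ∀ j → pivot P ≢ j → y j ≡ 0#
    off j p≢j = trans (cong y (sym (Fin.punchIn-punchOut p≢j))) (y-off (punchOut p≢j))

    y≡0 : ∀ j → y j ≡ 0#
    y≡0 j with pivot P Fin.≟ j
    ... | no  p≢j  = off j p≢j
    ... | yes refl = trans (sym (dot-at-pivot P y off)) (trans (sym (B-vec P y)) y⊥P)

  Π₁⊥ : Pt₂ → V → Set
  Π₁⊥ P y = InΠ₁ y × B (vec P) y ≡ 0#

  Π₁⊥-linearlyClosed : ∀ P → LinearlyClosed (Π₁⊥ P)
  Π₁⊥-linearlyClosed P c g g∈ = InΠ₁-linearlyClosed c g (proj₁ ∘ g∈) , ⊥-linearlyClosed (vec P) c g (proj₂ ∘ g∈)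

  Π₁⊥-determined : ∀ P → DeterminedBy (Π₁⊥ P) (λ i → punchIn (pivot P) (suc (suc (suc i))))
  Π₁⊥-determined P y ((y₀≡0 , y₁≡0 , y₂≡0) , y⊥P) y-rest = ⊥-determined P y y⊥P λ
    { zero → y₀≡0 ; (suc zero) → y₁≡0 ; (suc (suc zero)) → y₂≡0 ; (suc (suc (suc i))) → y-rest i }

  vec₂-scaled : ∀ {x y z κ a b c} → x ≡ κ * a → y ≡ κ * b → z ≡ κ * c → ∀ j → vec₂ x y z j ≡ κ * vec₂ a b c j
  vec₂-scaled x≡ y≡ z≡ zero                = x≡
  vec₂-scaled x≡ y≡ z≡ (suc zero)          = y≡
  vec₂-scaled x≡ y≡ z≡ (suc (suc zero))    = z≡
  vec₂-scaled x≡ y≡ z≡ (suc (suc (suc _))) = sym (zeroʳ _)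

  normalise : Carrier → Carrier → Carrier → Pt₂
  normalise x y z with x ≟ 0# | y ≟ 0#
  ... | no x≢0 | _      = pA (y * inv x x≢0) (z * inv x x≢0)
  ... | yes _  | no y≢0 = pB (z * inv y y≢0)
  ... | yes _  | yes _  = pC

  normalise-scaling : ∀ x y z → ¬ (x ≡ 0# × y ≡ 0# × z ≡ 0#) →
                      Σ Carrier λ κ → κ ≢ 0# × (∀ j → vec₂ x y z j ≡ κ * vec′ (normalise x y z) j)
  normalise-scaling x y z xyz≢0 with x ≟ 0# | y ≟ 0#
  ... | no x≢0   | _       = x , x≢0 , vec₂-scaled (sym (*-identityʳ x)) (sym (*-inv-cancelˡ x≢0 y)) (sym (*-inv-cancelˡ x≢0 z))
  ... | yes x≡0  | no y≢0  = y , y≢0 , vec₂-scaled (trans x≡0 (sym (zeroʳ y))) (sym (*-identityʳ y)) (sym (*-inv-cancelˡ y≢0 z))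
  ... | yes x≡0  | yes y≡0 = z , (λ z≡0 → xyz≢0 (x≡0 , y≡0 , z≡0))
                           , vec₂-scaled (trans x≡0 (sym (zeroʳ z))) (trans y≡0 (sym (zeroʳ z))) (sym (*-identityʳ z))

  private
    ratio : ∀ {u v κ a} (u≢0 : u ≢ 0#) → u ≡ κ * 1# → v ≡ κ * a → v * inv u u≢0 ≡ a
    ratio {u} {v} {κ} {a} u≢0 u≡κ v≡κa = begin
      v * inv u u≢0              ≡⟨ cong (_* inv u u≢0) (trans v≡κa (solve 2 (λ κ a → κ :* a := a :* (κ :* :1#)) refl κ a)) ⟩
      a * (κ * 1#) * inv u u≢0   ≡⟨ cong (λ t → a * t * inv u u≢0) (sym u≡κ) ⟩
      a * u * inv u u≢0          ≡⟨ *-inv-cancelʳ a u≢0 ⟩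
      a                          ∎

  normalise-unique : ∀ {x y z κ} P → κ ≢ 0# → x ≡ κ * vec′ P (# 0) → y ≡ κ * vec′ P (# 1) → z ≡ κ * vec′ P (# 2) → normalise x y z ≡ P
  normalise-unique {x} {y} {z} {κ} P κ≢0 x≡ y≡ z≡ with P | x ≟ 0# | y ≟ 0# | x≡ | y≡ | z≡
  ... | pA a b | no x≢0  | _       | x≡κ | y≡κa | z≡κb = cong₂ pA (ratio x≢0 x≡κ y≡κa) (ratio x≢0 x≡κ z≡κb)
  ... | pA a b | yes x≡0 | _       | x≡κ | _    | _    = ⊥-elim (κ≢0 (trans (sym (*-identityʳ κ)) (trans (sym x≡κ) x≡0)))
  ... | pB b   | no x≢0  | _       | x≡0 | _    | _    = ⊥-elim (x≢0 (trans x≡0 (zeroʳ κ)))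
  ... | pB b   | yes _   | no y≢0  | _   | y≡κ  | z≡κb = cong pB (ratio y≢0 y≡κ z≡κb)
  ... | pB b   | yes _   | yes y≡0 | _   | y≡κ  | _    = ⊥-elim (κ≢0 (trans (sym (*-identityʳ κ)) (trans (sym y≡κ) y≡0)))
  ... | pC     | no x≢0  | _       | x≡0 | _    | _    = ⊥-elim (x≢0 (trans x≡0 (zeroʳ κ)))
  ... | pC     | yes _   | no y≢0  | _   | y≡0  | _    = ⊥-elim (y≢0 (trans y≡0 (zeroʳ κ)))
  ... | pC     | yes _   | yes _   | _   | _    | _    = refl

  vec-proportional : ∀ {P P′ κ} → (∀ j → vec P j ≡ κ * vec P′ j) → P ≡ P′
  vec-proportional {P} {P′} {κ} P≗κP′ = trans (sym (normalise-unique P 1≢0 (one (# 0)) (one (# 1)) (one (# 2))))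
                                              (normalise-unique P′ κ≢0 (scaled (# 0)) (scaled (# 1)) (scaled (# 2)))
    where
    one : ∀ j → vec′ P j ≡ 1# * vec′ P j
    one j = sym (*-identityˡ _)
    scaled : ∀ j → vec′ P j ≡ κ * vec′ P′ j
    scaled j = trans (sym (vec≗vec′ P j)) (trans (P≗κP′ j) (cong (κ *_) (vec≗vec′ P′ j)))
    κ≢0 : κ ≢ 0#
    κ≢0 κ≡0 = vec-¬InΠ₁ P (vanish (# 0) , vanish (# 1) , vanish (# 2))
      where vanish = λ j → trans (P≗κP′ j) (trans (cong (_* vec P′ j) κ≡0) (zeroˡ _))

  _≟Pt_ : (P Q : Pt₂) → Dec (P ≡ Q)
  pA a b ≟Pt pA a′ b′ with a ≟ a′ | b ≟ b′
  ... | yes refl | yes refl = yes refl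
  ... | no a≢a′  | _        = no λ { refl → a≢a′ refl }
  ... | yes _    | no b≢b′  = no λ { refl → b≢b′ refl }
  pB b ≟Pt pB b′ with b ≟ b′
  ... | yes refl = yes refl
  ... | no b≢b′  = no λ { refl → b≢b′ refl }
  pC     ≟Pt pC     = yes refl
  pA _ _ ≟Pt pB _   = no λ ()
  pA _ _ ≟Pt pC     = no λ ()
  pB _   ≟Pt pA _ _ = no λ ()
  pB _   ≟Pt pC     = no λ ()
  pC     ≟Pt pA _ _ = no λ ()
  pC     ≟Pt pB _   = no λ ()

  record LineOfPoints (x y z : Carrier) : Set where
    field
      points   : List Pt₂
      unique   : Unique points
      on-line  : All (λ P → dot P x y z ≡ 0#) points
      complete : ∀ P → dot P x y z ≡ 0# → P ∈ points
      size     : length points ≡ ℕ.suc (FiniteField.order F)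

  private
    pA-injectiveˡ : ∀ {a a′ b b′} → pA a b ≡ pA a′ b′ → a ≡ a′
    pA-injectiveˡ refl = refl

    pA-injectiveʳ : ∀ {a a′ b b′} → pA a b ≡ pA a′ b′ → b ≡ b′
    pA-injectiveʳ refl = refl

    pB-injective : ∀ {b b′} → pB b ≡ pB b′ → b ≡ b′
    pB-injective refl = refl

    enumerated-line : ∀ {x y z} (Q : Pt₂) (f : Carrier → Pt₂) → (∀ {a a′} → f a ≡ f a′ → a ≡ a′) → (∀ a → Q ≢ f a) →
           dot Q x y z ≡ 0# → (∀ a → dot (f a) x y z ≡ 0#) → (∀ P → dot P x y z ≡ 0# → P ≡ Q ⊎ ∃ λ a → P ≡ f a) →
           LineOfPoints x y z
    enumerated-line Q f f-injective Q∉f Q-on f-on points-on = record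
      { points   = Q ∷ map f elements
      ; unique   = All.map⁺ (All.universal Q∉f elements) ∷ Unique.map⁺ f-injective elements-unique
      ; on-line  = Q-on ∷ All.map⁺ (All.universal f-on elements)
      ; complete = λ P P-on → member (points-on P P-on)
      ; size     = cong ℕ.suc (length-map f elements)
      }
      where
      member : ∀ {P} → P ≡ Q ⊎ ∃ (λ a → P ≡ f a) → P ∈ Q ∷ map f elements
      member (inj₁ refl)       = here refl
      member (inj₂ (a , refl)) = there (∈-map⁺ f (elements-complete a))

    +*0 : ∀ {z} → z ≡ 0# → ∀ e b → e + b * z ≡ e
    +*0 z≡0 e b = trans (cong (λ t → e + b * t) z≡0) (solve 2 (λ e b → e :+ b :* :0# := e) refl e b)

  lineOfPoints : ∀ x y z → ¬ (x ≡ 0# × y ≡ 0# × z ≡ 0#) → LineOfPoints x y z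
  lineOfPoints x y z xyz≢0 with z ≟ 0# | y ≟ 0#
  ... | no z≢0 | _ = enumerated-line (pB (root y)) (λ a → pA a (root (x + a * y))) pA-injectiveˡ (λ _ ())
                          (root-correct y z≢0) (λ a → root-correct (x + a * y) z≢0) on
    where
    root = λ e → - inv z z≢0 * e
    on : ∀ P → dot P x y z ≡ 0# → P ≡ pB (root y) ⊎ ∃ λ a → P ≡ pA a (root (x + a * y))
    on (pA a b) P-on = inj₂ (a , cong (pA a) (root-unique z≢0 P-on))
    on (pB b)   P-on = inj₁ (cong pB (root-unique z≢0 P-on))
    on pC       z≡0  = ⊥-elim (z≢0 z≡0)
  ... | yes z≡0 | no y≢0 = enumerated-line pC (λ b → pA (root x) b) pA-injectiveʳ (λ _ ())
                                z≡0 (λ b → trans (+*0 z≡0 _ b) (root-correct x y≢0)) on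
    where
    root = λ e → - inv y y≢0 * e
    on : ∀ P → dot P x y z ≡ 0# → P ≡ pC ⊎ ∃ λ b → P ≡ pA (root x) b
    on (pA a b) P-on = inj₂ (b , cong (λ t → pA t b) (root-unique y≢0 (trans (sym (+*0 z≡0 _ b)) P-on)))
    on (pB b)   P-on = ⊥-elim (y≢0 (trans (sym (+*0 z≡0 y b)) P-on))
    on pC       _    = inj₁ refl
  ... | yes z≡0 | yes y≡0 = enumerated-line pC pB pB-injective (λ _ ()) z≡0 (λ b → trans (+*0 z≡0 y b) y≡0) on
    where
    on : ∀ P → dot P x y z ≡ 0# → P ≡ pC ⊎ ∃ λ b → P ≡ pB b
    on (pA a b) P-on = ⊥-elim (xyz≢0 (trans (sym (trans (+*0 z≡0 _ b) (+*0 y≡0 x a))) P-on , y≡0 , z≡0))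
    on (pB b)   _    = inj₂ (b , refl)
    on pC       _    = inj₁ refl

module Planes (F : FiniteField) (C : (P : Geometry.Pt₂ F) → Geometry.Choice F P) where
  open FieldFacts F
  open Geometry F
  open LinearAlgebra F
  open Symplectic F
  open Coordinates F
  open PointsOfΠ₂ F
  open Choice

  disjoint-unique : ∀ {ℓs ℓ ℓ′ v} → AllPairs Disjoint ℓs → ℓ ∈ ℓs → ℓ′ ∈ ℓs →
                    NonZero v → v ∈⟨ ℓ ⟩ → v ∈⟨ ℓ′ ⟩ → ℓ ≡ ℓ′
  disjoint-unique _            (here refl) (here refl) _   _   _    = refl
  disjoint-unique (ℓ# ∷ _)     (here refl) (there ℓ′∈) v≢0 v∈ℓ v∈ℓ′ = ⊥-elim (v≢0 (All.lookup ℓ# ℓ′∈ _ v∈ℓ v∈ℓ′))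
  disjoint-unique (ℓ′# ∷ _)    (there ℓ∈) (here refl) v≢0 v∈ℓ v∈ℓ′ = ⊥-elim (v≢0 (All.lookup ℓ′# ℓ∈ _ v∈ℓ′ v∈ℓ))
  disjoint-unique (_ ∷ disj)   (there ℓ∈) (there ℓ′∈) v≢0 v∈ℓ v∈ℓ′ = disjoint-unique disj ℓ∈ ℓ′∈ v≢0 v∈ℓ v∈ℓ′

  Σ⟨_⟩ : Pt₂ → Solid
  Σ⟨ P ⟩ = Σ-P (C P)

  spread-line : ∀ P {ℓ} → ℓ ∈ spread (C P) → LinIndep ℓ × TotallyIsotropic ℓ × (∀ i → ℓ i ∈⟨ Σ⟨ P ⟩ ⟩)
  spread-line P = All.lookup (spread-lines (C P))

  spread-unique : ∀ P {ℓ ℓ′ v} → ℓ ∈ spread (C P) → ℓ′ ∈ spread (C P) → NonZero v → v ∈⟨ ℓ ⟩ → v ∈⟨ ℓ′ ⟩ → ℓ ≡ ℓ′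
  spread-unique P = disjoint-unique (spread-disj (C P))

  ⟨Σ⟩-⊥ : ∀ P {v} → v ∈⟨ Σ⟨ P ⟩ ⟩ → B (vec P) v ≡ 0#
  ⟨Σ⟩-⊥ P = ∈⟨⟩-⊥ {x = vec P} {g = Σ⟨ P ⟩} (Σ-in-P⊥ (C P))

  P∷Σ-linIndep : ∀ P → LinIndep (vec P ∷ᵥ Σ⟨ P ⟩)
  P∷Σ-linIndep P = ∷-linIndep {g = Σ⟨ P ⟩} (Σ-indep (C P)) (P∉Σ (C P))

  ⊥-spanned : ∀ P {x} → B (vec P) x ≡ 0# → x ∈⟨ vec P ∷ᵥ Σ⟨ P ⟩ ⟩
  ⊥-spanned P {x} = ∈⟨⟩-of-independent-within (punchIn (pivot P)) (⊥-linearlyClosed (vec P)) (⊥-determined P)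
                                               (vec P ∷ᵥ Σ⟨ P ⟩) (P∷Σ-linIndep P) generators-⊥ x
    where
    generators-⊥ : ∀ i → B (vec P) ((vec P ∷ᵥ Σ⟨ P ⟩) i) ≡ 0#
    generators-⊥ zero    = B-alternating (vec P)
    generators-⊥ (suc i) = Σ-in-P⊥ (C P) i

  Π₁⊥⊆r : ∀ P {r} → r ∈ spread (C P) → IsMeet r Σ⟨ P ⟩ Π₁ → ∀ y → Π₁⊥ P y → y ∈⟨ r ⟩
  Π₁⊥⊆r P {r} r∈F r-meet = ∈⟨⟩-of-independent-within (λ i → punchIn (pivot P) (suc (suc (suc i))))
                              (Π₁⊥-linearlyClosed P) (Π₁⊥-determined P) r (proj₁ (spread-line P r∈F)) r⊆Π₁⊥
    where
    r⊆Π₁⊥ : ∀ i → Π₁⊥ P (r i)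
    r⊆Π₁⊥ i = ∈Π₁⇒InΠ₁ (proj₂ (proj₁ (r-meet (r i)) (∈⟨⟩-gen r i))) , ⟨Σ⟩-⊥ P (proj₂ (proj₂ (spread-line P r∈F)) i)

  module PlanesThrough (R : V) (R∉Π₁ : ¬ (R ∈⟨ Π₁ ⟩)) (R∉Π₂ : ¬ (R ∈⟨ Π₂ ⟩)) (ℓR : Line) (R∈ℓR : R ∈⟨ ℓR ⟩)
                 (u w : V) (u≢0 : NonZero u) (w≢0 : NonZero w) (u∈ℓR : u ∈⟨ ℓR ⟩) (w∈ℓR : w ∈⟨ ℓR ⟩)
                 (u∈Π₁ : InΠ₁ u) (w∈Π₂ : InΠ₂ w) where
    open ≡-Reasoning

    line-basis : ∀ {x} → x ∈⟨ ℓR ⟩ → Σ Carrier λ α → Σ Carrier λ β → ∀ j → x j ≡ α * u j + β * w j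
    line-basis {x} x∈ℓR = coefficients (∈⟨⟩-of-independent-in-span ℓR (u ∷ᵥ w ∷ᵥ []ᵥ)
                            (Π₁Π₂-linIndep u≢0 w≢0 u∈Π₁ w∈Π₂) (λ { zero → u∈ℓR ; (suc zero) → w∈ℓR }) x x∈ℓR)
      where
      coefficients : x ∈⟨ u ∷ᵥ w ∷ᵥ []ᵥ ⟩ → Σ Carrier λ α → Σ Carrier λ β → ∀ j → x j ≡ α * u j + β * w j
      coefficients (c , x≗cuw) = c zero , c (suc zero) , λ j → trans (x≗cuw j) (cong (c zero * u j +_) (+-identityʳ _))

    -- Opaque for the same reason as ∈⟨⟩-of-independent-within.
    opaque
      α β : Carrier
      α = proj₁ (line-basis R∈ℓR)
      β = proj₁ (proj₂ (line-basis R∈ℓR))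

      R≗αu+βw : ∀ j → R j ≡ α * u j + β * w j
      R≗αu+βw = proj₂ (proj₂ (line-basis R∈ℓR))

    R-zero-at : ∀ {j} → α * u j ≡ 0# → β * w j ≡ 0# → R j ≡ 0#
    R-zero-at {j} αu≡0 βw≡0 = trans (R≗αu+βw j) (trans (cong₂ _+_ αu≡0 βw≡0) (+-identityʳ 0#))

    α≢0 : α ≢ 0#
    α≢0 α≡0 = R∉Π₂ (InΠ₂⇒∈Π₂ (at (proj₁ w∈Π₂) , at (proj₁ (proj₂ w∈Π₂)) , at (proj₂ (proj₂ w∈Π₂))))
      where
      at : ∀ {j} → w j ≡ 0# → R j ≡ 0#
      at w≡0 = R-zero-at (trans (cong (_* _) α≡0) (zeroˡ _)) (trans (cong (β *_) w≡0) (zeroʳ β))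

    β≢0 : β ≢ 0#
    β≢0 β≡0 = R∉Π₁ (InΠ₁⇒∈Π₁ (at (proj₁ u∈Π₁) , at (proj₁ (proj₂ u∈Π₁)) , at (proj₂ (proj₂ u∈Π₁))))
      where
      at : ∀ {j} → u j ≡ 0# → R j ≡ 0#
      at u≡0 = R-zero-at (trans (cong (α *_) u≡0) (zeroʳ α)) (trans (cong (_* _) β≡0) (zeroˡ _))

    R⊥ : Pt₂ → Set
    R⊥ P = B (vec P) R ≡ 0#

    -- The Π₂-component of R, and the point ℓR ∩ Π₂ it spans.
    R₂ : V
    R₂ = vec₂ (R (# 0)) (R (# 1)) (R (# 2))

    PR : Pt₂
    PR = normalise (R (# 0)) (R (# 1)) (R (# 2))

    R-low≢0 : ¬ (R (# 0) ≡ 0# × R (# 1) ≡ 0# × R (# 2) ≡ 0#)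
    R-low≢0 = R∉Π₁ ∘ InΠ₁⇒∈Π₁

    R-high≢0 : ¬ (R (# 3) ≡ 0# × R (# 4) ≡ 0# × R (# 5) ≡ 0#)
    R-high≢0 = R∉Π₂ ∘ InΠ₂⇒∈Π₂

    κ : Carrier
    κ = proj₁ (normalise-scaling _ _ _ R-low≢0)

    κ≢0 : κ ≢ 0#
    κ≢0 = proj₁ (proj₂ (normalise-scaling _ _ _ R-low≢0))

    R₂≗κPR : ∀ j → R₂ j ≡ κ * vec PR j
    R₂≗κPR j = trans (proj₂ (proj₂ (normalise-scaling _ _ _ R-low≢0)) j) (cong (κ *_) (sym (vec≗vec′ PR j)))

    R₂≗βw : ∀ j → R₂ j ≡ 0# * u j + β * w j
    R₂≗βw = coordinatewise (λ j → R₂ j ≡ 0# * u j + β * w j)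
      (low (proj₁ u∈Π₁)) (low (proj₁ (proj₂ u∈Π₁))) (low (proj₂ (proj₂ u∈Π₁)))
      (high (proj₁ w∈Π₂)) (high (proj₁ (proj₂ w∈Π₂))) (high (proj₂ (proj₂ w∈Π₂)))
      where
      low : ∀ {j} → u j ≡ 0# → R j ≡ 0# * u j + β * w j
      low {j} u≡0 = trans (R≗αu+βw j) (cong (_+ β * w j) (trans (cong (α *_) u≡0) (trans (zeroʳ α) (sym (zeroˡ (u j))))))
      high : ∀ {j} → w j ≡ 0# → 0# ≡ 0# * u j + β * w j
      high {j} w≡0 = sym (trans (cong (λ t → 0# * u j + β * t) w≡0) (solve 2 (λ x β → :0# :* x :+ β :* :0# := :0#) refl (u j) β))

    B[R₂,R] : B R₂ R ≡ (0# * β + - (β * α)) * B u w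
    B[R₂,R] = trans (B-cong R₂≗βw R≗αu+βw) (B-bilinear u w 0# β α β)

    B[PR,R] : κ * B (vec PR) R ≡ B R₂ R
    B[PR,R] = trans (sym (B-scaleˡ (vec PR) R κ)) (B-cong {y = R} (sym ∘ R₂≗κPR) (λ _ → refl))

    -βα≢0 : 0# * β + - (β * α) ≢ 0#
    -βα≢0 = -‿≢0 (*-≢0 β≢0 α≢0) ∘ trans (solve 2 (λ β α → :- (β :* α) := :0# :* β :+ :- (β :* α)) refl β α)

    isotropic⇒PR⊥R : TotallyIsotropic ℓR → R⊥ PR
    isotropic⇒PR⊥R isotropic = x*y≡0⇒y≡0 κ≢0 (begin
      κ * B (vec PR) R                   ≡⟨ trans B[PR,R] B[R₂,R] ⟩
      (0# * β + - (β * α)) * B u w       ≡⟨ cong ((0# * β + - (β * α)) *_) (isotropic u w u∈ℓR w∈ℓR) ⟩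
      (0# * β + - (β * α)) * 0#          ≡⟨ zeroʳ _ ⟩
      0#                                 ∎)

    PR⊥R⇒isotropic : R⊥ PR → TotallyIsotropic ℓR
    PR⊥R⇒isotropic PR⊥R x y x∈ℓR y∈ℓR =
      let α₁ , β₁ , x≗ = line-basis x∈ℓR
          α₂ , β₂ , y≗ = line-basis y∈ℓR
      in begin
        B x y                                        ≡⟨ trans (B-cong x≗ y≗) (B-bilinear u w α₁ β₁ α₂ β₂) ⟩
        (α₁ * β₂ + - (β₁ * α₂)) * B u w              ≡⟨ cong ((α₁ * β₂ + - (β₁ * α₂)) *_) B[u,w]≡0 ⟩
        (α₁ * β₂ + - (β₁ * α₂)) * 0#                 ≡⟨ zeroʳ _ ⟩
        0#                                           ∎
      where
      B[u,w]≡0 : B u w ≡ 0#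
      B[u,w]≡0 = x*y≡0⇒y≡0 -βα≢0 (trans (sym B[R₂,R]) (trans (sym B[PR,R]) (trans (cong (κ *_) PR⊥R) (zeroʳ κ))))

    open LineOfPoints (lineOfPoints (R (# 3)) (R (# 4)) (R (# 5)) R-high≢0)
    open Removal _≟Pt_

    candidates : List Pt₂
    candidates = remove PR points

    candidates-unique : Unique candidates
    candidates-unique = Unique.filter⁺ (λ P → ¬? (P ≟Pt PR)) unique

    candidate⇒ : ∀ {P} → P ∈ candidates → R⊥ P × P ≢ PR
    candidate⇒ {P} P∈ = let P∈points , P≢PR = ∈-filter⁻ (λ P → ¬? (P ≟Pt PR)) P∈
                        in trans (B-vec P R) (All.lookup on-line P∈points) , P≢PR

    ⇒candidate : ∀ {P} → R⊥ P → P ≢ PR → P ∈ candidates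
    ⇒candidate {P} P⊥R = ∈-filter⁺ (λ P → ¬? (P ≟Pt PR)) (complete P (trans (sym (B-vec P R)) P⊥R))

    #candidates-isotropic : TotallyIsotropic ℓR → length candidates ≡ FiniteField.order F
    #candidates-isotropic isotropic = ℕ.suc-injective (trans (length-remove-∈ unique PR∈points) size)
      where PR∈points = complete PR (trans (sym (B-vec PR R)) (isotropic⇒PR⊥R isotropic))

    #candidates-nonisotropic : ¬ TotallyIsotropic ℓR → length candidates ≡ ℕ.suc (FiniteField.order F)
    #candidates-nonisotropic nonisotropic = trans (cong length (remove-∉ PR∉points)) size
      where PR∉points = λ PR∈ → nonisotropic (PR⊥R⇒isotropic (trans (B-vec PR R) (All.lookup on-line PR∈)))

    split-∉Π₂ : ∀ {P l m} → (∀ j → R j ≡ l * vec P j + m j) → ¬ InΠ₂ m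
    split-∉Π₂ {P} {l} {m} R≗ (m₃ , m₄ , m₅) =
      R-high≢0 (at (proj₁ (vec-InΠ₂ P)) m₃ , at (proj₁ (proj₂ (vec-InΠ₂ P))) m₄ , at (proj₂ (proj₂ (vec-InΠ₂ P))) m₅)
      where
      at : ∀ {j} → vec P j ≡ 0# → m j ≡ 0# → R j ≡ 0#
      at {j} P≡0 m≡0 = trans (R≗ j) (trans (cong₂ (λ s t → l * s + t) P≡0 m≡0) (solve 1 (λ l → l :* :0# :+ :0# := :0#) refl l))

    split-Π₁⇒PR : ∀ {P l m} → (∀ j → R j ≡ l * vec P j + m j) → InΠ₁ m → P ≡ PR
    split-Π₁⇒PR {P} {l} {m} R≗ (m₀ , m₁ , m₂) with l ≟ 0#
    ... | yes l≡0 = ⊥-elim (R-low≢0 (vanish m₀ , vanish m₁ , vanish m₂))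
      where
      vanish : ∀ {j} → m j ≡ 0# → R j ≡ 0#
      vanish {j} m≡0 = trans (R≗ j) (trans (cong₂ (λ s t → s * vec P j + t) l≡0 m≡0) (solve 1 (λ v → :0# :* v :+ :0# := :0#) refl (vec P j)))
    ... | no l≢0 = sym (normalise-unique P l≢0 (at m₀) (at m₁) (at m₂))
      where
      at : ∀ {j} → m j ≡ 0# → R j ≡ l * vec′ P j
      at {j} m≡0 = trans (R≗ j) (trans (cong₂ (λ s t → l * s + t) (vec≗vec′ P j) m≡0) (+-identityʳ _))

    opaque
      split : ∀ P → R⊥ P → Fin 5 → Carrier
      split P P⊥R = proj₁ (⊥-spanned P {R} P⊥R)

      R≗split : ∀ P (P⊥R : R⊥ P) j → R j ≡ lincomb (split P P⊥R) (vec P ∷ᵥ Σ⟨ P ⟩) j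
      R≗split P P⊥R = proj₂ (⊥-spanned P {R} P⊥R)

    -- The Σ_P-component of R in P^⊥ = ⟨P⟩ ⊕ Σ_P.
    σ : ∀ P → R⊥ P → V
    σ P P⊥R = lincomb (split P P⊥R ∘ suc) Σ⟨ P ⟩

    R≗λP+σ : ∀ P (P⊥R : R⊥ P) j → R j ≡ split P P⊥R zero * vec P j + σ P P⊥R j
    R≗λP+σ = R≗split

    σ-unique : ∀ P (P⊥R : R⊥ P) a e → (∀ j → R j ≡ a * vec P j + lincomb e Σ⟨ P ⟩ j) → ∀ j → lincomb e Σ⟨ P ⟩ j ≡ σ P P⊥R j
    σ-unique P P⊥R a e R≗ j = lincomb-cong Σ⟨ P ⟩ j λ i →
      lincomb-injective {g = vec P ∷ᵥ Σ⟨ P ⟩} (P∷Σ-linIndep P) (a ∷ᵥ e) (split P P⊥R) (λ j → trans (sym (R≗ j)) (R≗split P P⊥R j)) (suc i)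

    σ≢0 : ∀ P (P⊥R : R⊥ P) → NonZero (σ P P⊥R)
    σ≢0 P P⊥R σ≡0 = split-∉Π₂ {P} (R≗λP+σ P P⊥R) (σ≡0 (# 3) , σ≡0 (# 4) , σ≡0 (# 5))

    opaque
      σ-line : ∀ P (P⊥R : R⊥ P) → ∃ λ ℓ → ℓ ∈ spread (C P) × σ P P⊥R ∈⟨ ℓ ⟩
      σ-line P P⊥R = find (spread-cover (C P) (σ P P⊥R) (σ≢0 P P⊥R) (split P P⊥R ∘ suc , λ _ → refl))

    line : ∀ P → R⊥ P → Line
    line P P⊥R = proj₁ (σ-line P P⊥R)

    line∈spread : ∀ P (P⊥R : R⊥ P) → line P P⊥R ∈ spread (C P)
    line∈spread P P⊥R = proj₁ (proj₂ (σ-line P P⊥R))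

    σ∈line : ∀ P (P⊥R : R⊥ P) → σ P P⊥R ∈⟨ line P P⊥R ⟩
    σ∈line P P⊥R = proj₂ (proj₂ (σ-line P P⊥R))

    plane : ∀ P → R⊥ P → Plane
    plane P P⊥R = join (vec P) (line P P⊥R)

    -- The Π₁-component u′ = R − κ P_R of R lies in Π₁ ∩ P_R^⊥, which is the line r; so it is σ.
    line-of-PR : ∀ (PR⊥R : R⊥ PR) {r} → r ∈ spread (C PR) → IsMeet r Σ⟨ PR ⟩ Π₁ → line PR PR⊥R ≡ r
    line-of-PR PR⊥R {r} r∈F r-meet = spread-unique PR (line∈spread PR PR⊥R) r∈F (σ≢0 PR PR⊥R) (σ∈line PR PR⊥R) σ∈r
      where
      u′ : V
      u′ j = - κ * vec PR j + R j

      u′-low : ∀ {j} → R j ≡ κ * vec PR j → u′ j ≡ 0#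
      u′-low {j} R≡κPR = trans (cong (- κ * vec PR j +_) R≡κPR) (solve 2 (λ κ v → :- κ :* v :+ κ :* v := :0#) refl κ (vec PR j))

      u′⊥PR : B (vec PR) u′ ≡ 0#
      u′⊥PR = begin
        B (vec PR) u′                                ≡⟨ B-linearʳ (vec PR) (vec PR) R (- κ) ⟩
        - κ * B (vec PR) (vec PR) + B (vec PR) R     ≡⟨ cong₂ (λ s t → - κ * s + t) (B-alternating (vec PR)) PR⊥R ⟩
        - κ * 0# + 0#                                ≡⟨ solve 1 (λ κ → :- κ :* :0# :+ :0# := :0#) refl κ ⟩
        0#                                           ∎

      u′∈r : u′ ∈⟨ r ⟩
      u′∈r = Π₁⊥⊆r PR r∈F r-meet u′ ((u′-low (R₂≗κPR (# 0)) , u′-low (R₂≗κPR (# 1)) , u′-low (R₂≗κPR (# 2))) , u′⊥PR)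

      u′∈Σ : u′ ∈⟨ Σ⟨ PR ⟩ ⟩
      u′∈Σ = ∈⟨⟩-trans {g = r} {h = Σ⟨ PR ⟩} (proj₂ (proj₂ (spread-line PR r∈F))) u′∈r

      R≗κPR+u′ : ∀ j → R j ≡ κ * vec PR j + lincomb (proj₁ u′∈Σ) Σ⟨ PR ⟩ j
      R≗κPR+u′ j = trans (solve 3 (λ κ v r → r := κ :* v :+ (:- κ :* v :+ r)) refl κ (vec PR j) (R j))
                         (cong (κ * vec PR j +_) (proj₂ u′∈Σ j))

      σ∈r : σ PR PR⊥R ∈⟨ r ⟩
      σ∈r = ∈⟨⟩-resp {g = r} (λ j → trans (proj₂ u′∈Σ j) (σ-unique PR PR⊥R κ (proj₁ u′∈Σ) R≗κPR+u′ j)) u′∈r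

    line-meets-Π₁ : ∀ P (P⊥R : R⊥ P) → P ≡ PR → IsMeet (line P P⊥R) Σ⟨ P ⟩ Π₁
    line-meets-Π₁ P P⊥R refl with find (r∈spread (C PR))
    ... | r , r∈F , r-meet = subst (λ ℓ → IsMeet ℓ Σ⟨ PR ⟩ Π₁) (sym (line-of-PR P⊥R r∈F r-meet)) r-meet

    σ-in-meet : ∀ P (P⊥R : R⊥ P) (X : Plane) → IsMeet (line P P⊥R) Σ⟨ P ⟩ X → σ P P⊥R ∈⟨ X ⟩
    σ-in-meet P P⊥R X meet = proj₂ (proj₁ (meet (σ P P⊥R)) (σ∈line P P⊥R))

    line-avoids-Π₂ : ∀ P (P⊥R : R⊥ P) → ¬ IsMeet (line P P⊥R) Σ⟨ P ⟩ Π₂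
    line-avoids-Π₂ P P⊥R meet = split-∉Π₂ {P} (R≗λP+σ P P⊥R) (∈Π₂⇒InΠ₂ (σ-in-meet P P⊥R Π₂ meet))

    line-avoids-Π₁ : ∀ P (P⊥R : R⊥ P) → P ≢ PR → ¬ IsMeet (line P P⊥R) Σ⟨ P ⟩ Π₁
    line-avoids-Π₁ P P⊥R P≢PR meet = P≢PR (split-Π₁⇒PR {P} (R≗λP+σ P P⊥R) (∈Π₁⇒InΠ₁ (σ-in-meet P P⊥R Π₁ meet)))

    plane-linIndep : ∀ P (P⊥R : R⊥ P) → LinIndep (plane P P⊥R)
    plane-linIndep P P⊥R =
      ∷-linIndep {p = vec P} {g = line P P⊥R} ℓ-indep (λ P∈ℓ → P∉Σ (C P) (∈⟨⟩-trans {g = line P P⊥R} {h = Σ⟨ P ⟩} ℓ⊆Σ P∈ℓ))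
      where
      ℓ-indep = proj₁ (spread-line P (line∈spread P P⊥R))
      ℓ⊆Σ = proj₂ (proj₂ (spread-line P (line∈spread P P⊥R)))

    R∈plane : ∀ P (P⊥R : R⊥ P) → R ∈⟨ plane P P⊥R ⟩
    R∈plane P P⊥R = let e , σ≗eℓ = σ∈line P P⊥R
                    in (split P P⊥R zero ∷ᵥ e) , λ j → trans (R≗λP+σ P P⊥R j) (cong (split P P⊥R zero * vec P j +_) (σ≗eℓ j))

    plane∈X : ∀ P (P⊥R : R⊥ P) → P ≢ PR → InX C (plane P P⊥R)
    plane∈X P P⊥R P≢PR = inj₂ (P , lose (line∈spread P P⊥R) (line-avoids-Π₁ P P⊥R P≢PR , line-avoids-Π₂ P P⊥R , λ _ → id , id))

    -- The ℓ′-component of P lies in Π₂, so it vanishes unless ℓ′ = t_P′.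
    plane-injective : ∀ P (P⊥R : R⊥ P) P′ (P′⊥R : R⊥ P′) → plane P P⊥R ≐ plane P′ P′⊥R → P ≡ P′
    plane-injective P P⊥R P′ P′⊥R same = proportional-or-on-t (Fin.all? (λ j → n j ≟ 0#))
      where
      P∈plane′ = proj₁ (same (vec P)) (∈⟨⟩-gen (plane P P⊥R) zero)
      c = proj₁ P∈plane′
      n = lincomb (c ∘ suc) (line P′ P′⊥R)

      P≗ : ∀ j → vec P j ≡ c zero * vec P′ j + n j
      P≗ = proj₂ P∈plane′

      n-high : ∀ {j} → vec P j ≡ 0# → vec P′ j ≡ 0# → n j ≡ 0#
      n-high {j} P≡0 P′≡0 = sym (begin
        0#                          ≡⟨ sym P≡0 ⟩
        vec P j                     ≡⟨ P≗ j ⟩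
        c zero * vec P′ j + n j     ≡⟨ cong (λ s → c zero * s + n j) P′≡0 ⟩
        c zero * 0# + n j           ≡⟨ solve 2 (λ c n → c :* :0# :+ n := n) refl (c zero) (n j) ⟩
        n j                         ∎)

      n∈Π₂ : n ∈⟨ Π₂ ⟩
      n∈Π₂ = InΠ₂⇒∈Π₂ ( n-high (proj₁ (vec-InΠ₂ P)) (proj₁ (vec-InΠ₂ P′))
                      , n-high (proj₁ (proj₂ (vec-InΠ₂ P))) (proj₁ (proj₂ (vec-InΠ₂ P′)))
                      , n-high (proj₂ (proj₂ (vec-InΠ₂ P))) (proj₂ (proj₂ (vec-InΠ₂ P′))))

      n∈ℓ′ : n ∈⟨ line P′ P′⊥R ⟩
      n∈ℓ′ = c ∘ suc , λ _ → refl

      proportional-or-on-t : Dec (IsZero n) → P ≡ P′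
      proportional-or-on-t (yes n≡0) = vec-proportional λ j → trans (P≗ j) (trans (cong (c zero * vec P′ j +_) (n≡0 j)) (+-identityʳ _))
      proportional-or-on-t (no  n≢0) with find (t∈spread (C P′))
      ... | t , t∈F , t-meet = ⊥-elim (line-avoids-Π₂ P′ P′⊥R (subst (λ ℓ → IsMeet ℓ Σ⟨ P′ ⟩ Π₂) (sym ℓ′≡t) t-meet))
        where
        n∈t : n ∈⟨ t ⟩
        n∈t = proj₂ (t-meet n) (∈⟨⟩-trans {g = line P′ P′⊥R} {h = Σ⟨ P′ ⟩} (proj₂ (proj₂ (spread-line P′ (line∈spread P′ P′⊥R)))) n∈ℓ′ , n∈Π₂)
        ℓ′≡t : line P′ P′⊥R ≡ t
        ℓ′≡t = spread-unique P′ (line∈spread P′ P′⊥R) t∈F n≢0 n∈ℓ′ n∈t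

    covered : ∀ π → InX C π → R ∈⟨ π ⟩ → Σ Pt₂ λ P → P ∈ candidates × (∀ P⊥R → π ≐ plane P P⊥R)
    covered π (inj₁ π≐Π₂) R∈π = ⊥-elim (R∉Π₂ (proj₁ (π≐Π₂ R) R∈π))
    covered π (inj₂ (P , ℓ-choice)) R∈π with find ℓ-choice
    ... | ℓ , ℓ∈F , ℓ-avoids-Π₁ , _ , π≐Pℓ = P , ⇒candidate P⊥R P≢PR , λ P⊥R′ → subst (λ ℓ → π ≐ join (vec P) ℓ) (ℓ≡line P⊥R′) π≐Pℓ
      where
      R∈Pℓ = proj₁ (π≐Pℓ R) R∈π
      c = proj₁ R∈Pℓ
      ℓ⊆Σ = proj₂ (proj₂ (spread-line P ℓ∈F))

      P⊥R : R⊥ P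
      P⊥R = ∈⟨⟩-⊥ {x = vec P} {g = join (vec P) ℓ} generators-⊥ R∈Pℓ
        where
        generators-⊥ : ∀ i → B (vec P) (join (vec P) ℓ i) ≡ 0#
        generators-⊥ zero    = B-alternating (vec P)
        generators-⊥ (suc i) = ⟨Σ⟩-⊥ P (ℓ⊆Σ i)

      m∈ℓ : lincomb (c ∘ suc) ℓ ∈⟨ ℓ ⟩
      m∈ℓ = c ∘ suc , λ _ → refl

      m∈Σ : lincomb (c ∘ suc) ℓ ∈⟨ Σ⟨ P ⟩ ⟩
      m∈Σ = ∈⟨⟩-trans {g = ℓ} {h = Σ⟨ P ⟩} ℓ⊆Σ m∈ℓ

      ℓ≡line : ∀ P⊥R′ → ℓ ≡ line P P⊥R′
      ℓ≡line P⊥R′ = spread-unique P ℓ∈F (line∈spread P P⊥R′) (σ≢0 P P⊥R′) σ∈ℓ (σ∈line P P⊥R′)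
        where
        R≗ : ∀ j → R j ≡ c zero * vec P j + lincomb (proj₁ m∈Σ) Σ⟨ P ⟩ j
        R≗ j = trans (proj₂ R∈Pℓ j) (cong (c zero * vec P j +_) (proj₂ m∈Σ j))
        σ∈ℓ : σ P P⊥R′ ∈⟨ ℓ ⟩
        σ∈ℓ = ∈⟨⟩-resp {g = ℓ} (λ j → trans (proj₂ m∈Σ j) (σ-unique P P⊥R′ (c zero) (proj₁ m∈Σ) R≗ j)) m∈ℓ

      P≢PR : P ≢ PR
      P≢PR P≡PR = ℓ-avoids-Π₁ (subst (λ ℓ → IsMeet ℓ Σ⟨ P ⟩ Π₁) (sym (ℓ≡line P⊥R)) (line-meets-Π₁ P P⊥R P≡PR))

    planes-counted : ∀ {n} → length candidates ≡ n → PlanesThroughCount C R n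
    planes-counted #candidates =
        planes
      , trans (length-mapWith∈ (setoid Pt₂) candidates) #candidates
      , mapWith∈-All candidates (λ P∈ → let P⊥R , P≢PR = candidate⇒ P∈ in plane-linIndep _ P⊥R , plane∈X _ P⊥R P≢PR , R∈plane _ P⊥R)
      , mapWith∈-AllPairs candidates-unique (λ P∈ Q∈ P≢Q same → P≢Q (plane-injective _ _ _ _ same))
      , λ π _ π∈X R∈π → let P , P∈ , covers = covered π π∈X R∈π in mapWith∈⁺ _ (P , P∈ , covers _)
      where
      planes : List Plane
      planes = mapWith∈ candidates (λ P∈ → plane _ (proj₁ (candidate⇒ P∈)))

    planes-through-R : (TotallyIsotropic ℓR → PlanesThroughCount C R (FiniteField.order F))
                     × (¬ TotallyIsotropic ℓR → PlanesThroughCount C R (ℕ.suc (FiniteField.order F)))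
    planes-through-R = planes-counted ∘ #candidates-isotropic , planes-counted ∘ #candidates-nonisotropic

mainTheorem17 : (F : FiniteField) → (q : ℕ) → FiniteField.order F ≡ q →
    let open Geometry F in
    (C : (P : Pt₂) → Choice P) →
    (R : V) → NonZero R → ¬ (R ∈⟨ Π₁ ⟩) → ¬ (R ∈⟨ Π₂ ⟩) →
    (ℓR : Line) → LinIndep ℓR → R ∈⟨ ℓR ⟩ →
    (∃ λ u → NonZero u × u ∈⟨ ℓR ⟩ × u ∈⟨ Π₁ ⟩) →
    (∃ λ w → NonZero w × w ∈⟨ ℓR ⟩ × w ∈⟨ Π₂ ⟩) →
      (TotallyIsotropic ℓR → PlanesThroughCount C R q)
      × (¬ TotallyIsotropic ℓR → PlanesThroughCount C R (suc q))
mainTheorem17 F _ refl C R _ R∉Π₁ R∉Π₂ ℓR _ R∈ℓR (u , u≢0 , u∈ℓR , u∈Π₁) (w , w≢0 , w∈ℓR , w∈Π₂) =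
  PlanesThrough.planes-through-R R R∉Π₁ R∉Π₂ ℓR R∈ℓR u w u≢0 w≢0 u∈ℓR w∈ℓR (∈Π₁⇒InΠ₁ u∈Π₁) (∈Π₂⇒InΠ₂ w∈Π₂)
  where
  open Coordinates F
  open Planes F C
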